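{- Let $a=\{a_1,\dots,a_m\}$ be a set of positive integers. For an integer $k$, let $F(a,k)$ be the graph with vertex set $\mathbb{Z}/k\mathbb{Z}$ in which vertices $i,j$ are adjacent iff $i-j\equiv a_r\pmod k$ or $j-i\equiv a_r\pmod k$ for some $r$, and let $\overline{F}(a,k)$ be the graph obtained from $F(a,k)$ by attaching to each vertex $v$ a new vertex $v'$ joined to $v$ by a single edge (the new vertices being distinct and having no other edges). For sufficiently large $k_1,\dots,k_s$, let $\overline{F}=\overline{F}(a,k_1)+\cdots+\overline{F}(a,k_s)$. Then the number of $n$-element independent sets of $\overline{F}$ depends only on $a$, $n$, and $\sum_i k_i$.
   Context: $F_1+\cdots+F_s$ denotes the disjoint union of graphs. An $n$-element independent set is a set of $n$ vertices no two of which are adjacent. -}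

module Defs where

open import Data.Nat using (ℕ; zero; suc; _<_; _≟_)
open import Data.Nat.Divisibility using (_∣_; _∣?_)
open import Data.Integer using (ℤ; +_; _-_; ∣_∣)
open import Data.Bool using (Bool; true; false)
open import Data.Product using (Σ; _×_; _,_)
open import Data.Product.Properties using (≡-dec)
open import Data.Sum using (_⊎_)
open import Data.Empty using (⊥)
open import Data.List using (List; []; _∷_; _++_; map; length; filter; upTo; concatMap)
open import Data.List.Relation.Unary.Any using (Any; any?)
open import Data.List.Relation.Unary.AllPairs using (AllPairs; allPairs?)
open import Relation.Nullary using (¬_; Dec; yes; no)
open import Relation.Nullary.Decidable using (_×-dec_; _⊎-dec_; ¬?)
open import Relation.Binary.PropositionalEquality using (_≡_)

-- A vertex of Fbar(a,k_1)+...+Fbar(a,k_s):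
--   comp    = index i of the component (0-based),
--   size    = k_i (the modulus of that component),
--   pos     = residue x ∈ {0,…,k_i-1} representing x ∈ ℤ/k_iℤ,
--   pendant = false for the cycle-like vertex x, true for its attached new vertex x'.
record Vertex : Set where
  constructor vtx
  field
    comp    : ℕ
    size    : ℕ
    pos     : ℕ
    pendant : Bool
open Vertex public

CongMod : ℕ → ℤ → ℤ → Set
CongMod k x y = k ∣ ∣ x - y ∣

FAdj : List ℕ → ℕ → ℕ → ℕ → Set
FAdj a k x y = Any (λ r → CongMod k (+ x - + y) (+ r) ⊎ CongMod k (+ y - + x) (+ r)) a

FbarAdj : List ℕ → ℕ → ℕ → Bool → ℕ → Bool → Set
FbarAdj a k x false y false = FAdj a k x y
FbarAdj a k x false y true  = x ≡ y
FbarAdj a k x true  y false = x ≡ y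
FbarAdj a k x true  y true  = ⊥

Adj : List ℕ → Vertex → Vertex → Set
Adj a u v = (comp u ≡ comp v) × FbarAdj a (size u) (pos u) (pendant u) (pos v) (pendant v)

FAdj? : ∀ a k x y → Dec (FAdj a k x y)
FAdj? a k x y = any? (λ r → (k ∣? ∣ (+ x - + y) - + r ∣) ⊎-dec (k ∣? ∣ (+ y - + x) - + r ∣)) a

FbarAdj? : ∀ a k x b y c → Dec (FbarAdj a k x b y c)
FbarAdj? a k x false y false = FAdj? a k x y
FbarAdj? a k x false y true  = x ≟ y
FbarAdj? a k x true  y false = x ≟ y
FbarAdj? a k x true  y true  = no (λ ())

Adj? : ∀ a u v → Dec (Adj a u v)
Adj? a u v = (comp u ≟ comp v) ×-dec FbarAdj? a (size u) (pos u) (pendant u) (pos v) (pendant v)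

compVertices : ℕ → ℕ → List Vertex
compVertices i k = concatMap (λ x → vtx i k x false ∷ vtx i k x true ∷ []) (upTo k)

unionVertices : ℕ → List ℕ → List Vertex
unionVertices i []       = []
unionVertices i (k ∷ ks) = compVertices i k ++ unionVertices (suc i) ks

-- All sublists (by position) of a list: for a repetition-free list these are its subsets.
sublists : {A : Set} → List A → List (List A)
sublists []       = [] ∷ []
sublists (x ∷ xs) = sublists xs ++ map (x ∷_) (sublists xs)

IsIndepOfSize : List ℕ → ℕ → List Vertex → Set
IsIndepOfSize a n S = (length S ≡ n) × AllPairs (λ u v → ¬ Adj a u v) S

IsIndepOfSize? : ∀ a n S → Dec (IsIndepOfSize a n S)
IsIndepOfSize? a n S = (length S ≟ n) ×-dec allPairs? (λ u v → ¬? (Adj? a u v)) S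

indepCount : List ℕ → ℕ → List ℕ → ℕ
indepCount a n ks = length (filter (IsIndepOfSize? a n) (sublists (unionVertices 0 ks)))

-- Merging lemma: for k₁, k₂ ≥ K and j ≤ n, F̄(a,k₁)+F̄(a,k₂) and F̄(a,k₁+k₂) have equally many
-- j-element independent sets.  Encode subsets as bit masks.  Among the n+1 windows
-- [c, c+d), c = 0, d, …, n·d, a set of at most n vertices leaves some window empty in BOTH
-- cycles; exchanging the prefixes [0, c) of the two masks at the first such window is an
-- involution, and it carries independent sets of the two cycles to those of the long cycle:
-- read from the empty window on, both graphs are the same "linear" graph, since no difference
-- a_r ≤ d jumps across an empty window of length d.
-- Reduction: the count of a disjoint union is the convolution of the counts of its components
-- and ignores component labels, so merging two components preserves it; iterating collapses
-- ks to the single component Σ ks.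
-- Order: list and mask utilities; modular arithmetic; rotated cycles and the two-block picture;
-- counting and disjoint unions; the exchange involution; cutting at a window; merging; theorem.
module Submission where

open import Defs
open import Data.Nat using (ℕ; _<_; _≤_; zero; suc; _+_; _*_; _∸_; _%_; _/_; _⊓_; _⊔_;
  NonZero; >-nonZero; z≤n; s≤s; _<?_; _≤?_; _≟_)
open import Data.Nat.Properties
open import Data.Nat.DivMod
open import Data.Nat.Divisibility using (_∣_; divides)
open import Data.Nat.ListAction using (sum)
open import Data.Nat.Tactic.RingSolver using (solve-∀)
open import Data.Integer as ℤ using (_⊖_; ∣_∣)
import Data.Integer.Properties as ℤₚ
open import Data.Bool using (Bool; true; false; _∨_)
import Data.Bool as Bool
open import Data.Bool.Properties using (∨-comm)
open import Data.Maybe as Maybe using (Maybe; just; nothing)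
open import Data.Product as Product using (_×_; _,_; proj₁; proj₂; ∃-syntax)
open import Data.Sum as Sum using (_⊎_; inj₁; inj₂)
open import Data.Empty using (⊥; ⊥-elim)
open import Data.List using (List; []; _∷_; _++_; map; length; filter; take; drop; zipWith;
  foldr; upTo; applyUpTo; concatMap)
open import Data.List.Properties using (map-++; map-∘; map-id; length-++;
  length-map; length-drop; length-zipWith; ++-assoc; filter-≐; filter-none; filter-++; length-take; take++drop≡id; drop-drop; zipWith-comm; ∷-injectiveʳ)
open import Data.List.Relation.Unary.Any as Any using (Any; here; there)
open import Data.List.Relation.Unary.All as All using (All; []; _∷_; all?)
import Data.List.Relation.Unary.All.Properties as Allₚ
open import Data.List.Relation.Unary.All.Properties using (All¬⇒¬Any)
open import Data.List.Relation.Unary.AllPairs using (AllPairs; []; _∷_; allPairs?)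
import Data.List.Relation.Unary.AllPairs.Properties as AllPairsₚ
open import Data.List.Relation.Unary.Unique.Propositional using (Unique)
import Data.List.Relation.Unary.Unique.Propositional.Properties as Uniqueₚ
open import Data.List.Membership.Propositional using (_∈_)
open import Data.List.Membership.Propositional.Properties using (∈-map⁻; ∈-map⁺; ∈-++⁺ˡ; ∈-++⁺ʳ)
open import Data.List.Membership.Propositional.Properties.WithK using (unique∧set⇒bag)
open import Data.List.Relation.Binary.BagAndSetEquality using (∼bag⇒↭)
open import Data.List.Relation.Binary.Permutation.Propositional using (_↭_; ↭⇒↭ₛ; module PermutationReasoning)
import Data.List.Relation.Binary.Permutation.Propositional.Properties as Perm
import Data.List.Relation.Binary.Permutation.Setoid.Properties as PermSetoid
open import Function using (_∘_; id)
open import Function.Bundles using (mk⇔)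
open import Relation.Binary.PropositionalEquality
open import Relation.Nullary using (¬_; Dec; yes; no)
open import Relation.Nullary.Decidable using (_×-dec_; ¬?)
open import Relation.Unary using (Decidable)

Iff : Set → Set → Set
Iff A B = (A → B) × (B → A)

count : {A : Set} {P : A → Set} → Decidable P → List A → ℕ
count P? xs = length (filter P? xs)

count-cong-on : {A : Set} {P Q : A → Set} (P? : Decidable P) (Q? : Decidable Q) {xs : List A} →
  All (λ x → Iff (P x) (Q x)) xs → count P? xs ≡ count Q? xs
count-cong-on P? Q? [] = refl
count-cong-on P? Q? {x ∷ xs} (e ∷ es) with P? x | Q? x
... | yes p | yes q = cong suc (count-cong-on P? Q? es)
... | yes p | no ¬q = ⊥-elim (¬q (proj₁ e p))
... | no ¬p | yes q = ⊥-elim (¬p (proj₂ e q))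
... | no ¬p | no ¬q = count-cong-on P? Q? es

count-cong : {A : Set} {P Q : A → Set} (P? : Decidable P) (Q? : Decidable Q) →
  (∀ x → Iff (P x) (Q x)) → (xs : List A) → count P? xs ≡ count Q? xs
count-cong P? Q? f xs = cong length (filter-≐ P? Q? ((λ {x} → proj₁ (f x)) , (λ {x} → proj₂ (f x))) xs)

count-none : {A : Set} {P : A → Set} (P? : Decidable P) → (∀ x → ¬ P x) → (xs : List A) → count P? xs ≡ 0
count-none P? f xs = cong length (filter-none P? {xs} (All.tabulate (λ {x} _ → f x)))

count-++ : {A : Set} {P : A → Set} (P? : Decidable P) (xs ys : List A) →
  count P? (xs ++ ys) ≡ count P? xs + count P? ys
count-++ P? xs ys = trans (cong length (filter-++ P? xs ys)) (length-++ (filter P? xs))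

count-map : {A B : Set} {P : B → Set} (P? : Decidable P) (f : A → B) (xs : List A) →
  count P? (map f xs) ≡ count (P? ∘ f) xs
count-map P? f [] = refl
count-map P? f (x ∷ xs) with P? (f x)
... | yes _ = cong suc (count-map P? f xs)
... | no _  = count-map P? f xs

Unique-map-involution : {A : Set} (φ : A → A) {xs : List A} →
  All (λ x → φ (φ x) ≡ x) xs → Unique xs → Unique (map φ xs)
Unique-map-involution φ [] [] = []
Unique-map-involution φ {x ∷ xs} (φφx ∷ φφxs) (x∉xs ∷ uxs) =
  Allₚ.map⁺ (distinct φφxs x∉xs) ∷ Unique-map-involution φ φφxs uxs
  where
  distinct : ∀ {ys} → All (λ y → φ (φ y) ≡ y) ys → All (λ y → ¬ x ≡ y) ys → All (λ y → ¬ φ x ≡ φ y) ys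
  distinct [] [] = []
  distinct (φφy ∷ φφys) (x≢y ∷ x≢ys) =
    (λ e → x≢y (trans (sym φφx) (trans (cong φ e) φφy))) ∷ distinct φφys x≢ys

-- Counting is invariant under an involution of a repetition-free list onto itself:
-- map φ xs is then a permutation of xs.
count-involution : {A : Set} {P : A → Set} (P? : Decidable P) (φ : A → A) (xs : List A) →
  Unique xs → (∀ x → x ∈ xs → φ (φ x) ≡ x) → (∀ x → x ∈ xs → φ x ∈ xs) →
  count P? xs ≡ count (P? ∘ φ) xs
count-involution P? φ xs uxs inv closed =
  trans (Perm.↭-length (Perm.filter-↭ P? xs↭φxs)) (count-map P? φ xs)
  where
  ⊆φxs : ∀ {v} → v ∈ xs → v ∈ map φ xs
  ⊆φxs {v} v∈ = subst (_∈ map φ xs) (inv v v∈) (∈-map⁺ φ (closed v v∈))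
  φxs⊆ : ∀ {v} → v ∈ map φ xs → v ∈ xs
  φxs⊆ v∈ with ∈-map⁻ φ v∈
  ... | (y , y∈ , refl) = closed y y∈
  xs↭φxs : xs ↭ map φ xs
  xs↭φxs = ∼bag⇒↭ (unique∧set⇒bag uxs (Unique-map-involution φ (All.tabulate (λ {x} → inv x)) uxs) (mk⇔ ⊆φxs φxs⊆))

-- Subsets as bit masks: masks n lists every Boolean list of length n exactly once, and the
-- sublists of xs are the selections of xs by the masks of length |xs|.
masks : ℕ → List (List Bool)
masks zero    = [] ∷ []
masks (suc n) = map (false ∷_) (masks n) ++ map (true ∷_) (masks n)

select : {A : Set} → List A → List Bool → List A
select []       m           = []
select (x ∷ xs) []          = []
select (x ∷ xs) (false ∷ m) = select xs m
select (x ∷ xs) (true  ∷ m) = x ∷ select xs m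

sublists≡select-masks : {A : Set} (xs : List A) → sublists xs ≡ map (select xs) (masks (length xs))
sublists≡select-masks [] = refl
sublists≡select-masks (x ∷ xs) = begin
  sublists xs ++ map (x ∷_) (sublists xs)
    ≡⟨ cong₂ (λ u v → u ++ map (x ∷_) v) (sublists≡select-masks xs) (sublists≡select-masks xs) ⟩
  map (select xs) M ++ map (x ∷_) (map (select xs) M)
    ≡⟨ cong₂ _++_ (map-∘ M) (trans (sym (map-∘ M)) (map-∘ M)) ⟩
  map (select (x ∷ xs)) (map (false ∷_) M) ++ map (select (x ∷ xs)) (map (true ∷_) M)
    ≡⟨ sym (map-++ (select (x ∷ xs)) (map (false ∷_) M) (map (true ∷_) M)) ⟩
  map (select (x ∷ xs)) (masks (length (x ∷ xs))) ∎
  where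
  open ≡-Reasoning
  M : List (List Bool)
  M = masks (length xs)

masks-length : ∀ n → All (λ m → length m ≡ n) (masks n)
masks-length zero    = refl ∷ []
masks-length (suc n) = Allₚ.++⁺ (Allₚ.map⁺ (All.map (cong suc) (masks-length n)))
                                (Allₚ.map⁺ (All.map (cong suc) (masks-length n)))

∈-masks : ∀ n m → length m ≡ n → m ∈ masks n
∈-masks zero    []          refl = here refl
∈-masks (suc n) (false ∷ m) refl = ∈-++⁺ˡ (∈-map⁺ (false ∷_) (∈-masks n m refl))
∈-masks (suc n) (true  ∷ m) refl = ∈-++⁺ʳ _ (∈-map⁺ (true ∷_) (∈-masks n m refl))

masks-unique : ∀ n → Unique (masks n)
masks-unique zero    = [] ∷ []
masks-unique (suc n) = Uniqueₚ.++⁺ (Uniqueₚ.map⁺ ∷-injectiveʳ (masks-unique n))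
                                   (Uniqueₚ.map⁺ ∷-injectiveʳ (masks-unique n)) disjoint
  where
  disjoint : ∀ {v} → ¬ (v ∈ map (false ∷_) (masks n) × v ∈ map (true ∷_) (masks n))
  disjoint (p , q) with ∈-map⁻ (false ∷_) p | ∈-map⁻ (true ∷_) q
  ... | (_ , _ , refl) | (_ , _ , ())

weight : List Bool → ℕ
weight []          = 0
weight (true  ∷ m) = suc (weight m)
weight (false ∷ m) = weight m

weight-++ : ∀ m₁ m₂ → weight (m₁ ++ m₂) ≡ weight m₁ + weight m₂
weight-++ []           m₂ = refl
weight-++ (true  ∷ m₁) m₂ = cong suc (weight-++ m₁ m₂)
weight-++ (false ∷ m₁) m₂ = weight-++ m₁ m₂

weight-take-drop : ∀ n (m : List Bool) → weight m ≡ weight (take n m) + weight (drop n m)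
weight-take-drop n m = trans (cong weight (sym (take++drop≡id n m))) (weight-++ (take n m) (drop n m))

weight-∨ : ∀ (m m′ : List Bool) → weight (zipWith _∨_ m m′) ≤ weight m + weight m′
weight-∨ []          m′           = z≤n
weight-∨ (_ ∷ m)     []           = z≤n
weight-∨ (false ∷ m) (false ∷ m′) = weight-∨ m m′
weight-∨ (false ∷ m) (true  ∷ m′) = subst (suc (weight (zipWith _∨_ m m′)) ≤_) (sym (+-suc (weight m) (weight m′)))
                                          (s≤s (weight-∨ m m′))
weight-∨ (true  ∷ m) (false ∷ m′) = s≤s (weight-∨ m m′)
weight-∨ (true  ∷ m) (true  ∷ m′) = s≤s (≤-trans (weight-∨ m m′) (+-monoʳ-≤ (weight m) (n≤1+n (weight m′))))

weight-pos : ∀ (m : List Bool) → ¬ All (_≡ false) m → 1 ≤ weight m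
weight-pos []          m≢0 = ⊥-elim (m≢0 [])
weight-pos (true  ∷ m) m≢0 = s≤s z≤n
weight-pos (false ∷ m) m≢0 = weight-pos m (λ p → m≢0 (refl ∷ p))

module _ {A : Set} where

  length-select : ∀ (xs : List A) m → length m ≡ length xs → length (select xs m) ≡ weight m
  length-select [] [] e = refl
  length-select (x ∷ xs) (true  ∷ m) e = cong suc (length-select xs m (suc-injective e))
  length-select (x ∷ xs) (false ∷ m) e = length-select xs m (suc-injective e)

  select-++ : ∀ (xs ys : List A) m₁ m₂ → length m₁ ≡ length xs →
    select (xs ++ ys) (m₁ ++ m₂) ≡ select xs m₁ ++ select ys m₂
  select-++ [] ys [] m₂ e = refl
  select-++ (x ∷ xs) ys (true  ∷ m₁) m₂ e = cong (x ∷_) (select-++ xs ys m₁ m₂ (suc-injective e))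
  select-++ (x ∷ xs) ys (false ∷ m₁) m₂ e = select-++ xs ys m₁ m₂ (suc-injective e)

  select-false : ∀ (xs : List A) m → All (_≡ false) m → select xs m ≡ []
  select-false [] m _ = refl
  select-false (x ∷ xs) [] _ = refl
  select-false (x ∷ xs) (.false ∷ m) (refl ∷ p) = select-false xs m p

  All-select : ∀ {P : A → Set} (xs : List A) m → All P xs → All P (select xs m)
  All-select [] m _ = []
  All-select (x ∷ xs) [] _ = []
  All-select (x ∷ xs) (true  ∷ m) (p ∷ ps) = p ∷ All-select xs m ps
  All-select (x ∷ xs) (false ∷ m) (p ∷ ps) = All-select xs m ps

select-map : {A B : Set} (f : A → B) (xs : List A) (m : List Bool) → select (map f xs) m ≡ map f (select xs m)
select-map f [] m = refl
select-map f (x ∷ xs) [] = refl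
select-map f (x ∷ xs) (true  ∷ m) = cong (f x ∷_) (select-map f xs m)
select-map f (x ∷ xs) (false ∷ m) = select-map f xs m

select-++₆ : {A : Set} (X₁ X₂ X₃ X₄ X₅ X₆ : List A) (m₁ m₂ m₃ m₄ m₅ m₆ : List Bool) →
  length m₁ ≡ length X₁ → length m₂ ≡ length X₂ → length m₃ ≡ length X₃ → length m₄ ≡ length X₄ → length m₅ ≡ length X₅ →
  select (X₁ ++ X₂ ++ X₃ ++ X₄ ++ X₅ ++ X₆) (m₁ ++ m₂ ++ m₃ ++ m₄ ++ m₅ ++ m₆)
    ≡ select X₁ m₁ ++ select X₂ m₂ ++ select X₃ m₃ ++ select X₄ m₄ ++ select X₅ m₅ ++ select X₆ m₆
select-++₆ X₁ X₂ X₃ X₄ X₅ X₆ m₁ m₂ m₃ m₄ m₅ m₆ l₁ l₂ l₃ l₄ l₅ =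
  trans (select-++ X₁ _ m₁ _ l₁) (cong (select X₁ m₁ ++_)
  (trans (select-++ X₂ _ m₂ _ l₂) (cong (select X₂ m₂ ++_)
  (trans (select-++ X₃ _ m₃ _ l₃) (cong (select X₃ m₃ ++_)
  (trans (select-++ X₄ _ m₄ _ l₄) (cong (select X₄ m₄ ++_)
  (select-++ X₅ _ m₅ _ l₅))))))))

take-length-++ : ∀ {A : Set} (xs ys : List A) n → length xs ≡ n → take n (xs ++ ys) ≡ xs
take-length-++ [] ys .0 refl = refl
take-length-++ (x ∷ xs) ys .(suc (length xs)) refl = cong (x ∷_) (take-length-++ xs ys _ refl)

drop-length-++ : ∀ {A : Set} (xs ys : List A) n → length xs ≡ n → drop n (xs ++ ys) ≡ ys
drop-length-++ [] ys .0 refl = refl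
drop-length-++ (x ∷ xs) ys .(suc (length xs)) refl = drop-length-++ xs ys _ refl

length-take-≤ : ∀ {A : Set} n (xs : List A) → n ≤ length xs → length (take n xs) ≡ n
length-take-≤ n xs n≤ = trans (length-take n xs) (m≤n⇒m⊓n≡m n≤)

zipWith-++ : ∀ (xs xs′ ys ys′ : List Bool) → length xs ≡ length xs′ →
  zipWith _∨_ (xs ++ ys) (xs′ ++ ys′) ≡ zipWith _∨_ xs xs′ ++ zipWith _∨_ ys ys′
zipWith-++ [] [] ys ys′ _ = refl
zipWith-++ (x ∷ xs) (x′ ∷ xs′) ys ys′ e = cong ((x ∨ x′) ∷_) (zipWith-++ xs xs′ ys ys′ (suc-injective e))

drop-zipWith : ∀ n (xs ys : List Bool) → drop n (zipWith _∨_ xs ys) ≡ zipWith _∨_ (drop n xs) (drop n ys)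
drop-zipWith zero    xs       ys       = refl
drop-zipWith (suc n) []       ys       = refl
drop-zipWith (suc n) (x ∷ xs) []       = sym (zipWith-comm _∨_ ∨-comm (drop n xs) [])
drop-zipWith (suc n) (x ∷ xs) (y ∷ ys) = drop-zipWith n xs ys

take-zipWith : ∀ n (xs ys : List Bool) → take n (zipWith _∨_ xs ys) ≡ zipWith _∨_ (take n xs) (take n ys)
take-zipWith zero    xs       ys       = refl
take-zipWith (suc n) []       ys       = refl
take-zipWith (suc n) (x ∷ xs) []       = refl
take-zipWith (suc n) (x ∷ xs) (y ∷ ys) = cong ((x ∨ y) ∷_) (take-zipWith n xs ys)

∨-false⁻ : ∀ (xs ys : List Bool) → length xs ≡ length ys → All (_≡ false) (zipWith _∨_ xs ys) →
  All (_≡ false) xs × All (_≡ false) ys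
∨-false⁻ [] [] _ _ = [] , []
∨-false⁻ (false ∷ xs) (false ∷ ys) e (_ ∷ p) =
  Product.map (refl ∷_) (refl ∷_) (∨-false⁻ xs ys (suc-injective e) p)
∨-false⁻ (false ∷ xs) (true ∷ ys) e (() ∷ p)
∨-false⁻ (true  ∷ xs) (y    ∷ ys) e (() ∷ p)

++-assoc₃ : {A : Set} (X Y Z W : List A) → (X ++ Y ++ Z) ++ W ≡ X ++ Y ++ Z ++ W
++-assoc₃ X Y Z W = trans (++-assoc X _ _) (cong (X ++_) (++-assoc Y Z _))

reverse₃-↭ : {A : Set} (X Y Z W : List A) → X ++ Y ++ Z ++ W ↭ Z ++ Y ++ X ++ W
reverse₃-↭ X Y Z W = begin
  X ++ Y ++ Z ++ W       ≡⟨ sym (++-assoc₃ X Y Z W) ⟩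
  (X ++ Y ++ Z) ++ W     ↭⟨ Perm.++⁺ʳ W reverse₃ ⟩
  (Z ++ Y ++ X) ++ W     ≡⟨ ++-assoc₃ Z Y X W ⟩
  Z ++ Y ++ X ++ W       ∎
  where
  open PermutationReasoning
  reverse₃ : X ++ Y ++ Z ↭ Z ++ Y ++ X
  reverse₃ = begin
    X ++ (Y ++ Z)    ↭⟨ Perm.++-comm X (Y ++ Z) ⟩
    (Y ++ Z) ++ X    ≡⟨ ++-assoc Y Z X ⟩
    Y ++ (Z ++ X)    ↭⟨ Perm.++-comm Y (Z ++ X) ⟩
    (Z ++ X) ++ Y    ≡⟨ ++-assoc Z X Y ⟩
    Z ++ (X ++ Y)    ↭⟨ Perm.++⁺ˡ Z (Perm.++-comm X Y) ⟩
    Z ++ (Y ++ X)    ∎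

AllPairs-↭ : {A : Set} {R : A → A → Set} → (∀ {x y} → R x y → R y x) →
  {xs ys : List A} → xs ↭ ys → AllPairs R xs → AllPairs R ys
AllPairs-↭ {A} R-sym xs↭ys = PermSetoid.AllPairs-resp-↭ (setoid A) R-sym ((λ { refl r → r }) , (λ { refl r → r })) (↭⇒↭ₛ xs↭ys)

AllPairs-mapWith : {A : Set} {P : A → Set} {R R′ : A → A → Set} {xs : List A} → All P xs →
  (∀ {x y} → P x → P y → R x y → R′ x y) → AllPairs R xs → AllPairs R′ xs
AllPairs-mapWith [] f [] = []
AllPairs-mapWith {P = P} {R} {R′} {x ∷ xs} (px ∷ ps) f (r ∷ rs) = row ps r ∷ AllPairs-mapWith ps f rs
  where
  row : ∀ {ys} → All P ys → All (R x) ys → All (R′ x) ys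
  row [] [] = []
  row (py ∷ pys) (q ∷ qs) = f px py q ∷ row pys qs

range : ℕ → ℕ → List ℕ
range s zero    = []
range s (suc n) = s ∷ range (suc s) n

length-range : ∀ s n → length (range s n) ≡ n
length-range s zero    = refl
length-range s (suc n) = cong suc (length-range (suc s) n)

range-++ : ∀ s m n → range s (m + n) ≡ range s m ++ range (s + m) n
range-++ s zero    n = cong (λ t → range t n) (sym (+-identityʳ s))
range-++ s (suc m) n = cong (s ∷_) (trans (range-++ (suc s) m n)
                                          (cong (λ t → range (suc s) m ++ range t n) (sym (+-suc s m))))

All-range : ∀ s n → All (λ x → s ≤ x × x < s + n) (range s n)
All-range s zero    = []
All-range s (suc n) = (≤-refl , subst (s <_) (sym (+-suc s n)) (s≤s (m≤m+n s n)))
  ∷ All.map (λ {x} (1+s≤x , x<) → ≤-trans (n≤1+n s) 1+s≤x , subst (x <_) (sym (+-suc s n)) x<) (All-range (suc s) n)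

map-range : ∀ (f : ℕ → ℕ) s t n → (∀ i → i < n → f (s + i) ≡ t + i) → map f (range s n) ≡ range t n
map-range f s t zero    h = refl
map-range f s t (suc n) h = cong₂ _∷_ fs≡t (map-range f (suc s) (suc t) n h′)
  where
  fs≡t : f s ≡ t
  fs≡t = trans (cong f (sym (+-identityʳ s))) (trans (h 0 (s≤s z≤n)) (+-identityʳ t))
  h′ : ∀ i → i < n → f (suc s + i) ≡ suc t + i
  h′ i i<n = trans (cong f (sym (+-suc s i))) (trans (h (suc i) (s≤s i<n)) (+-suc t i))

applyUpTo≡map-range : ∀ {B : Set} (f : ℕ → B) n → applyUpTo f n ≡ map f (range 0 n)
applyUpTo≡map-range f zero    = refl
applyUpTo≡map-range f (suc n) = cong (f 0 ∷_) (trans (applyUpTo≡map-range (f ∘ suc) n) (shift 0 n))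
  where
  shift : ∀ s n → map (f ∘ suc) (range s n) ≡ map f (range (suc s) n)
  shift s zero    = refl
  shift s (suc n) = cong (f (suc s) ∷_) (shift (suc s) n)

upTo≡range : ∀ n → upTo n ≡ range 0 n
upTo≡range n = trans (applyUpTo≡map-range id n) (map-id (range 0 n))

pendantPairs : {X : Set} → (ℕ → Bool → X) → List ℕ → List X
pendantPairs f []       = []
pendantPairs f (x ∷ xs) = f x false ∷ f x true ∷ pendantPairs f xs

module _ {X : Set} where

  pendantPairs-++ : ∀ (f : ℕ → Bool → X) xs ys → pendantPairs f (xs ++ ys) ≡ pendantPairs f xs ++ pendantPairs f ys
  pendantPairs-++ f []       ys = refl
  pendantPairs-++ f (x ∷ xs) ys = cong (λ t → f x false ∷ f x true ∷ t) (pendantPairs-++ f xs ys)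

  pendantPairs-map : ∀ (f : ℕ → Bool → X) (h : ℕ → ℕ) xs → pendantPairs f (map h xs) ≡ pendantPairs (f ∘ h) xs
  pendantPairs-map f h []       = refl
  pendantPairs-map f h (x ∷ xs) = cong (λ t → f (h x) false ∷ f (h x) true ∷ t) (pendantPairs-map f h xs)

  map-pendantPairs : ∀ {Y : Set} (g : X → Y) (f : ℕ → Bool → X) xs →
    map g (pendantPairs f xs) ≡ pendantPairs (λ o b → g (f o b)) xs
  map-pendantPairs g f []       = refl
  map-pendantPairs g f (x ∷ xs) = cong (λ t → g (f x false) ∷ g (f x true) ∷ t) (map-pendantPairs g f xs)

  length-pendantPairs : ∀ (f : ℕ → Bool → X) xs → length (pendantPairs f xs) ≡ length xs + length xs
  length-pendantPairs f []       = refl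
  length-pendantPairs f (x ∷ xs) =
    cong suc (trans (cong suc (length-pendantPairs f xs)) (sym (+-suc (length xs) (length xs))))

  All-pendantPairs : ∀ {P : ℕ → Set} {Q : X → Set} (f : ℕ → Bool → X) xs →
    (∀ {o} b → P o → Q (f o b)) → All P xs → All Q (pendantPairs f xs)
  All-pendantPairs f []       g []       = []
  All-pendantPairs f (x ∷ xs) g (p ∷ ps) = g false p ∷ g true p ∷ All-pendantPairs f xs g ps

compVertices≡ : ∀ i k → compVertices i k ≡ pendantPairs (vtx i k) (range 0 k)
compVertices≡ i k = trans (cong (concatMap pair) (upTo≡range k)) (concatMap-pair (range 0 k))
  where
  pair : ℕ → List Vertex
  pair x = vtx i k x false ∷ vtx i k x true ∷ []
  concatMap-pair : ∀ xs → concatMap pair xs ≡ pendantPairs (vtx i k) xs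
  concatMap-pair []       = refl
  concatMap-pair (x ∷ xs) = cong (λ t → vtx i k x false ∷ vtx i k x true ∷ t) (concatMap-pair xs)

-- Congruences modulo k.  Defs states x ≡ y (mod k) as k ∣ ∣x - y∣ over ℤ; we translate this
-- into the equality of remainders in ℕ, where positions on a cycle are computed.

∣⊖∣≡∸ : ∀ x z → z ≤ x → ∣ x ⊖ z ∣ ≡ x ∸ z
∣⊖∣≡∸ x z z≤x = trans (ℤₚ.∣m⊖n∣≡∣n⊖m∣ x z) (ℤₚ.∣⊖∣-≤ z≤x)

∣∸⇒%≡ : ∀ k x z .{{_ : NonZero k}} → z ≤ x → k ∣ (x ∸ z) → x % k ≡ z % k
∣∸⇒%≡ k x z z≤x (divides q eq) = begin
  x % k               ≡⟨ cong (_% k) (sym (m+[n∸m]≡n z≤x)) ⟩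
  (z + (x ∸ z)) % k   ≡⟨ cong (λ t → (z + t) % k) eq ⟩
  (z + q * k) % k     ≡⟨ [m+kn]%n≡m%n z q k ⟩
  z % k               ∎
  where open ≡-Reasoning

%≡⇒∣∸ : ∀ k x z .{{_ : NonZero k}} → x % k ≡ z % k → k ∣ (x ∸ z)
%≡⇒∣∸ k x z e = divides (x / k ∸ z / k) (begin
  x ∸ z                                        ≡⟨ cong₂ _∸_ (m≡m%n+[m/n]*n x k) (m≡m%n+[m/n]*n z k) ⟩
  (x % k + x / k * k) ∸ (z % k + z / k * k)    ≡⟨ cong (λ t → (t + x / k * k) ∸ (z % k + z / k * k)) e ⟩
  (z % k + x / k * k) ∸ (z % k + z / k * k)    ≡⟨ [m+n]∸[m+o]≡n∸o (z % k) _ _ ⟩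
  x / k * k ∸ z / k * k                        ≡⟨ sym (*-distribʳ-∸ k (x / k) (z / k)) ⟩
  (x / k ∸ z / k) * k                          ∎)
  where open ≡-Reasoning

∣⊖∣⇒%≡ : ∀ k x z .{{_ : NonZero k}} → k ∣ ∣ x ⊖ z ∣ → x % k ≡ z % k
∣⊖∣⇒%≡ k x z p with ≤-total z x
... | inj₁ z≤x = ∣∸⇒%≡ k x z z≤x (subst (k ∣_) (∣⊖∣≡∸ x z z≤x) p)
... | inj₂ x≤z = sym (∣∸⇒%≡ k z x x≤z (subst (k ∣_) (trans (ℤₚ.∣m⊖n∣≡∣n⊖m∣ x z) (∣⊖∣≡∸ z x x≤z)) p))

%≡⇒∣⊖∣ : ∀ k x z .{{_ : NonZero k}} → x % k ≡ z % k → k ∣ ∣ x ⊖ z ∣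
%≡⇒∣⊖∣ k x z e with ≤-total z x
... | inj₁ z≤x = subst (k ∣_) (sym (∣⊖∣≡∸ x z z≤x)) (%≡⇒∣∸ k x z e)
... | inj₂ x≤z = subst (k ∣_) (sym (trans (ℤₚ.∣m⊖n∣≡∣n⊖m∣ x z) (∣⊖∣≡∸ z x x≤z))) (%≡⇒∣∸ k z x (sym e))

[x-y]-r≡x⊖[y+r] : ∀ x y r → (ℤ.+ x ℤ.- ℤ.+ y) ℤ.- ℤ.+ r ≡ x ⊖ (y + r)
[x-y]-r≡x⊖[y+r] x y r = begin
  (ℤ.+ x ℤ.+ ℤ.- ℤ.+ y) ℤ.+ ℤ.- ℤ.+ r ≡⟨ ℤₚ.+-assoc (ℤ.+ x) (ℤ.- ℤ.+ y) (ℤ.- ℤ.+ r) ⟩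
  ℤ.+ x ℤ.+ (ℤ.- ℤ.+ y ℤ.+ ℤ.- ℤ.+ r) ≡⟨ cong (ℤ._+_ (ℤ.+ x)) (sym (ℤₚ.neg-distrib-+ (ℤ.+ y) (ℤ.+ r))) ⟩
  ℤ.+ x ℤ.+ ℤ.- (ℤ.+ y ℤ.+ ℤ.+ r)     ≡⟨ cong (λ t → ℤ.+ x ℤ.+ ℤ.- t) (sym (ℤₚ.pos-+ y r)) ⟩
  ℤ.+ x ℤ.+ ℤ.- (ℤ.+ (y + r))         ≡⟨ ℤₚ.m-n≡m⊖n x (y + r) ⟩
  x ⊖ (y + r)                         ∎
  where open ≡-Reasoning

congMod⇔ : ∀ k x y r .{{_ : NonZero k}} → Iff (CongMod k (ℤ.+ x ℤ.- ℤ.+ y) (ℤ.+ r)) (x % k ≡ (y + r) % k)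
congMod⇔ k x y r =
    (λ p → ∣⊖∣⇒%≡ k x (y + r) (subst (λ t → k ∣ ∣ t ∣) ([x-y]-r≡x⊖[y+r] x y r) p))
  , (λ e → subst (λ t → k ∣ ∣ t ∣) (sym ([x-y]-r≡x⊖[y+r] x y r)) (%≡⇒∣⊖∣ k x (y + r) e))

[x%k+r]%k≡[x+r]%k : ∀ k x r .{{_ : NonZero k}} → (x % k + r) % k ≡ (x + r) % k
[x%k+r]%k≡[x+r]%k k x r = begin
  (x % k + r) % k           ≡⟨ %-distribˡ-+ (x % k) r k ⟩
  (x % k % k + r % k) % k   ≡⟨ cong (λ t → (t + r % k) % k) (m%n%n≡m%n x k) ⟩
  (x % k + r % k) % k       ≡⟨ sym (%-distribˡ-+ x r k) ⟩
  (x + r) % k               ∎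
  where open ≡-Reasoning

%-cancelʳ-+ : ∀ k x y c .{{_ : NonZero k}} → (x + c) % k ≡ (y + c) % k → x % k ≡ y % k
%-cancelʳ-+ k x y c e = ∣⊖∣⇒%≡ k x y (subst (k ∣_) (cong ∣_∣ shift) (%≡⇒∣⊖∣ k (x + c) (y + c) e))
  where
  shift : (x + c) ⊖ (y + c) ≡ x ⊖ y
  shift = trans (cong₂ _⊖_ (+-comm x c) (+-comm y c)) (ℤₚ.+-cancelˡ-⊖ c x y)

%-congʳ-+ : ∀ k x y c .{{_ : NonZero k}} → x % k ≡ y % k → (x + c) % k ≡ (y + c) % k
%-congʳ-+ k x y c e = begin
  (x + c) % k       ≡⟨ sym ([x%k+r]%k≡[x+r]%k k x c) ⟩
  (x % k + c) % k   ≡⟨ cong (λ t → (t + c) % k) e ⟩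
  (y % k + c) % k   ≡⟨ [x%k+r]%k≡[x+r]%k k y c ⟩
  (y + c) % k       ∎
  where open ≡-Reasoning

-- Positions on the cycle ℤ/kℤ.  A step of length r ≤ d that wraps around the end of the cycle
-- lands below r, hence strictly below d; so between positions ≥ d steps never wrap.

%-wrap : ∀ k z .{{_ : NonZero k}} → k ≤ z → z < k + k → z % k ≡ z ∸ k
%-wrap k z k≤z z<2k = trans (sym (m≤n⇒[n∸m]%m≡n%m k≤z)) (m<n⇒m%n≡m z∸k<k)
  where
  z∸k<k : z ∸ k < k
  z∸k<k = subst (z ∸ k <_) (m+n∸m≡n k k) (∸-monoˡ-< z<2k k≤z)

wrapped-step< : ∀ k g r → g < k → k ≤ g + r → g + r ∸ k < r
wrapped-step< k g r g<k k≤ = subst (g + r ∸ k <_) (m+n∸m≡n k r) (∸-monoˡ-< (+-monoˡ-< r g<k) k≤)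

step⇔ : ∀ k g g′ r d .{{_ : NonZero k}} → r ≤ d → d ≤ g → g < k → g′ < k →
        Iff ((g′ + r) % k ≡ g % k) (g′ + r ≡ g)
step⇔ k g g′ r d r≤d d≤g g<k g′<k rewrite m<n⇒m%n≡m g<k with g′ + r <? k
... | yes g′+r<k rewrite m<n⇒m%n≡m g′+r<k = id , id
... | no g′+r≮k =
      (λ e → ⊥-elim (<⇒≢ (≤-trans (wrapped-step< k g′ r g′<k k≤) (≤-trans r≤d d≤g))
                            (trans (sym (%-wrap k (g′ + r) k≤ g′+r<2k)) e)))
    , (λ e → ⊥-elim (<⇒≱ g<k (subst (k ≤_) e k≤)))
  where
  k≤ : k ≤ g′ + r
  k≤ = ≮⇒≥ g′+r≮k
  g′+r<2k : g′ + r < k + k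
  g′+r<2k = +-mono-< g′<k (≤-<-trans r≤d (≤-<-trans d≤g g<k))

no-step-across : ∀ L k₁ g g′ r d .{{_ : NonZero L}} → r ≤ d → g < k₁ → k₁ + d ≤ g′ → g′ < L →
                 ¬ ((g + r) % L ≡ g′ % L)
no-step-across L k₁ g g′ r d r≤d g<k₁ le g′<L e =
  <⇒≢ g+r<g′ (trans (sym (m<n⇒m%n≡m (<-trans g+r<g′ g′<L))) (trans e (m<n⇒m%n≡m g′<L)))
  where
  g+r<g′ : g + r < g′
  g+r<g′ = <-≤-trans (+-mono-<-≤ g<k₁ r≤d) le

no-step-across-back : ∀ L k₁ g g′ r d .{{_ : NonZero L}} → r ≤ d → d ≤ g → g < k₁ → k₁ + d ≤ g′ → g′ < L →
                      ¬ ((g′ + r) % L ≡ g % L)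
no-step-across-back L k₁ g g′ r d r≤d d≤g g<k₁ le g′<L e with g′ + r <? L
... | yes g′+r<L = <⇒≢ g<g′+r (sym (trans (sym (m<n⇒m%n≡m g′+r<L)) (trans e (m<n⇒m%n≡m g<L))))
  where
  g<L : g < L
  g<L = <-trans (<-≤-trans g<k₁ (m≤m+n k₁ d)) (≤-<-trans le g′<L)
  g<g′+r : g < g′ + r
  g<g′+r = <-≤-trans (<-≤-trans g<k₁ (≤-trans (m≤m+n k₁ d) le)) (m≤m+n g′ r)
... | no g′+r≮L = <⇒≢ (≤-trans (wrapped-step< L g′ r g′<L L≤) (≤-trans r≤d d≤g))
                      (trans (sym (%-wrap L (g′ + r) L≤ g′+r<2L)) (trans e (m<n⇒m%n≡m g<L)))
  where
  L≤ : L ≤ g′ + r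
  L≤ = ≮⇒≥ g′+r≮L
  g<L : g < L
  g<L = <-trans (<-≤-trans g<k₁ (m≤m+n k₁ d)) (≤-<-trans le g′<L)
  g′+r<2L : g′ + r < L + L
  g′+r<2L = +-mono-< g′<L (≤-<-trans r≤d (≤-<-trans d≤g g<L))

rotated-congMod⇔ : ∀ k c g g′ r .{{_ : NonZero k}} →
  Iff (CongMod k (ℤ.+ ((g + c) % k) ℤ.- ℤ.+ ((g′ + c) % k)) (ℤ.+ r)) ((g′ + r) % k ≡ g % k)
rotated-congMod⇔ k c g g′ r =
    (λ p → sym (%-cancelʳ-+ k g (g′ + r) c (trans (sym (m%n%n≡m%n (g + c) k))
             (trans (proj₁ (congMod⇔ k _ _ r) p) (trans ([x%k+r]%k≡[x+r]%k k (g′ + c) r) (cong (_% k) reorder))))))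
  , (λ q → proj₂ (congMod⇔ k _ _ r) (trans (m%n%n≡m%n (g + c) k)
             (trans (%-congʳ-+ k g (g′ + r) c (sym q)) (trans (cong (_% k) (sym reorder)) (sym ([x%k+r]%k≡[x+r]%k k (g′ + c) r))))))
  where
  reorder : g′ + c + r ≡ g′ + r + c
  reorder = trans (+-assoc g′ c r) (trans (cong (g′ +_) (+-comm c r)) (sym (+-assoc g′ r c)))

Any-mapWith : ∀ {A : Set} {Q P P′ : A → Set} {xs : List A} →
  All Q xs → (∀ {x} → Q x → P x → P′ x) → Any P xs → Any P′ xs
Any-mapWith (q ∷ _)  f (here p)  = here (f q p)
Any-mapWith (_ ∷ qs) f (there p) = there (Any-mapWith qs f p)

-- A vertex at position
-- (g + c) % k is described by its offset g < k; "cycle adjacency" is the adjacency of F̄(a,k)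
-- read on offsets, and "line adjacency" the adjacency of the same graph on the integer line
-- (differences exactly a_r, no wrap-around).  The two agree on offsets ≥ d.
module RotatedCycle (a : List ℕ) (d : ℕ) (a≤d : All (_≤ d) a) where

  CycleAdj : (k : ℕ) .{{_ : NonZero k}} → ℕ → Bool → ℕ → Bool → Set
  CycleAdj k g false g′ false = Any (λ r → (g′ + r) % k ≡ g % k ⊎ (g + r) % k ≡ g′ % k) a
  CycleAdj k g false g′ true  = g ≡ g′
  CycleAdj k g true  g′ false = g ≡ g′
  CycleAdj k g true  g′ true  = ⊥

  LineAdj : ℕ → Bool → ℕ → Bool → Set
  LineAdj o false o′ false = Any (λ r → o′ + r ≡ o ⊎ o + r ≡ o′) a
  LineAdj o false o′ true  = o ≡ o′
  LineAdj o true  o′ false = o ≡ o′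
  LineAdj o true  o′ true  = ⊥

  rotated-≡⇔ : ∀ k c g g′ .{{_ : NonZero k}} → g < k → g′ < k →
    Iff ((g + c) % k ≡ (g′ + c) % k) (g ≡ g′)
  rotated-≡⇔ k c g g′ g<k g′<k =
      (λ e → trans (sym (m<n⇒m%n≡m g<k)) (trans (%-cancelʳ-+ k g g′ c e) (m<n⇒m%n≡m g′<k)))
    , cong (λ t → (t + c) % k)

  rotate⇔ : ∀ k c g g′ b b′ .{{_ : NonZero k}} → g < k → g′ < k →
    Iff (FbarAdj a k ((g + c) % k) b ((g′ + c) % k) b′) (CycleAdj k g b g′ b′)
  rotate⇔ k c g g′ false false _ _ =
      Any.map (Sum.map (proj₁ (rotated-congMod⇔ k c g g′ _)) (proj₁ (rotated-congMod⇔ k c g′ g _)))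
    , Any.map (Sum.map (proj₂ (rotated-congMod⇔ k c g g′ _)) (proj₂ (rotated-congMod⇔ k c g′ g _)))
  rotate⇔ k c g g′ false true  g<k g′<k = rotated-≡⇔ k c g g′ g<k g′<k
  rotate⇔ k c g g′ true  false g<k g′<k = rotated-≡⇔ k c g g′ g<k g′<k
  rotate⇔ k c g g′ true  true  _ _     = (λ ()) , (λ ())

  cycle⇔line : ∀ k g g′ b b′ .{{_ : NonZero k}} → d ≤ g → g < k → d ≤ g′ → g′ < k →
    Iff (CycleAdj k g b g′ b′) (LineAdj g b g′ b′)
  cycle⇔line k g g′ false false d≤g g<k d≤g′ g′<k =
      Any-mapWith a≤d (λ r≤d → Sum.map (proj₁ (step⇔ k g g′ _ d r≤d d≤g g<k g′<k)) (proj₁ (step⇔ k g′ g _ d r≤d d≤g′ g′<k g<k)))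
    , Any-mapWith a≤d (λ r≤d → Sum.map (proj₂ (step⇔ k g g′ _ d r≤d d≤g g<k g′<k)) (proj₂ (step⇔ k g′ g _ d r≤d d≤g′ g′<k g<k)))
  cycle⇔line k g g′ false true  _ _ _ _ = id , id
  cycle⇔line k g g′ true  false _ _ _ _ = id , id
  cycle⇔line k g g′ true  true  _ _ _ _ = (λ ()) , (λ ())

  LineAdj-shift : ∀ m o o′ b b′ → Iff (LineAdj (m + o) b (m + o′) b′) (LineAdj o b o′ b′)
  LineAdj-shift m o o′ false false =
      Any.map (Sum.map (λ e → +-cancelˡ-≡ m _ _ (trans (sym (+-assoc m o′ _)) e))
                       (λ e → +-cancelˡ-≡ m _ _ (trans (sym (+-assoc m o _)) e)))
    , Any.map (Sum.map (λ e → trans (+-assoc m o′ _) (cong (m +_) e))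
                       (λ e → trans (+-assoc m o _) (cong (m +_) e)))
  LineAdj-shift m o o′ false true  = +-cancelˡ-≡ m _ _ , cong (m +_)
  LineAdj-shift m o o′ true  false = +-cancelˡ-≡ m _ _ , cong (m +_)
  LineAdj-shift m o o′ true  true  = (λ ()) , (λ ())

  LineAdj-sym : ∀ o b o′ b′ → LineAdj o b o′ b′ → LineAdj o′ b′ o b
  LineAdj-sym o false o′ false p = Any.map Sum.swap p
  LineAdj-sym o false o′ true  p = sym p
  LineAdj-sym o true  o′ false p = sym p
  LineAdj-sym o true  o′ true  ()

  -- On ℤ/Lℤ, offsets g ∈ [d, k₁) and g′ ∈ [k₁ + d, L) are never adjacent: an empty arc
  -- of length d lies between them in either direction.
  no-CycleAdj-across : ∀ L k₁ g g′ b b′ .{{_ : NonZero L}} → d ≤ g → g < k₁ → k₁ + d ≤ g′ → g′ < L →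
    ¬ CycleAdj L g b g′ b′ × ¬ CycleAdj L g′ b′ g b
  no-CycleAdj-across L k₁ g g′ b b′ d≤g g<k₁ le g′<L = forward b b′ , backward b b′
    where
    g<g′ : g < g′
    g<g′ = <-≤-trans g<k₁ (≤-trans (m≤m+n k₁ d) le)
    forward : ∀ b b′ → ¬ CycleAdj L g b g′ b′
    forward false false = All¬⇒¬Any (All.map (λ r≤d → Sum.[ no-step-across-back L k₁ g g′ _ d r≤d d≤g g<k₁ le g′<L
                                                          , no-step-across L k₁ g g′ _ d r≤d g<k₁ le g′<L ]) a≤d)
    forward false true  = <⇒≢ g<g′
    forward true  false = <⇒≢ g<g′
    forward true  true  ()
    backward : ∀ b b′ → ¬ CycleAdj L g′ b′ g b
    backward false false = All¬⇒¬Any (All.map (λ r≤d → Sum.[ no-step-across L k₁ g g′ _ d r≤d g<k₁ le g′<L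
                                                           , no-step-across-back L k₁ g g′ _ d r≤d d≤g g<k₁ le g′<L ]) a≤d)
    backward true  false e = <⇒≢ g<g′ (sym e)
    backward false true  e = <⇒≢ g<g′ (sym e)
    backward true  true  ()

-- A "block vertex" (s, o, b) is
-- the vertex at offset o (pendant if b) of block s; block false has size k₁, block true size k₂.
-- It names a vertex of F̄(a,k₁)+F̄(a,k₂) (block s is cycle s, rotated by c) and a vertex of
-- F̄(a,k₁+k₂) (block true is placed after block false, the whole cycle rotated by c).  For
-- offsets in [d, k_s) both graphs induce the same "block adjacency": equal blocks and line
-- adjacency of the offsets.
module TwoBlocks (a : List ℕ) (d : ℕ) (a≤d : All (_≤ d) a) (k₁ k₂ c : ℕ)
                 {{_ : NonZero k₁}} {{_ : NonZero k₂}} {{_ : NonZero (k₁ + k₂)}} where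
  open RotatedCycle a d a≤d

  BlockVertex : Set
  BlockVertex = Bool × ℕ × Bool

  BlockAdj : BlockVertex → BlockVertex → Set
  BlockAdj (s , o , b) (s′ , o′ , b′) = (s ≡ s′) × LineAdj o b o′ b′

  BlockAdj-sym : ∀ u v → BlockAdj u v → BlockAdj v u
  BlockAdj-sym (s , o , b) (s′ , o′ , b′) (e , p) = sym e , LineAdj-sym o b o′ b′ p

  blockSize : Bool → ℕ
  blockSize false = k₁
  blockSize true  = k₂

  InRange : BlockVertex → Set
  InRange (s , o , b) = d ≤ o × o < blockSize s

  L : ℕ
  L = k₁ + k₂

  inTwoCycles : BlockVertex → Vertex
  inTwoCycles (false , o , b) = vtx 0 k₁ ((o + c) % k₁) b
  inTwoCycles (true  , o , b) = vtx 1 k₂ ((o + c) % k₂) b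

  inLongCycle : BlockVertex → Vertex
  inLongCycle (false , o , b) = vtx 0 L ((o + c) % L) b
  inLongCycle (true  , o , b) = vtx 0 L ((k₁ + o + c) % L) b

  rotated⇔line : ∀ k g g′ b b′ .{{_ : NonZero k}} → d ≤ g → g < k → d ≤ g′ → g′ < k →
    Iff (FbarAdj a k ((g + c) % k) b ((g′ + c) % k) b′) (LineAdj g b g′ b′)
  rotated⇔line k g g′ b b′ d≤g g<k d≤g′ g′<k =
      proj₁ (cycle⇔line k g g′ b b′ d≤g g<k d≤g′ g′<k) ∘ proj₁ (rotate⇔ k c g g′ b b′ g<k g′<k)
    , proj₂ (rotate⇔ k c g g′ b b′ g<k g′<k) ∘ proj₂ (cycle⇔line k g g′ b b′ d≤g g<k d≤g′ g′<k)

  twoCycles-adj⇔ : ∀ u v → InRange u → InRange v → Iff (Adj a (inTwoCycles u) (inTwoCycles v)) (BlockAdj u v)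
  twoCycles-adj⇔ (false , o , b) (false , o′ , b′) (d≤o , o<) (d≤o′ , o′<) =
      (λ p → refl , proj₁ (rotated⇔line k₁ o o′ b b′ d≤o o< d≤o′ o′<) (proj₂ p))
    , (λ p → refl , proj₂ (rotated⇔line k₁ o o′ b b′ d≤o o< d≤o′ o′<) (proj₂ p))
  twoCycles-adj⇔ (true , o , b) (true , o′ , b′) (d≤o , o<) (d≤o′ , o′<) =
      (λ p → refl , proj₁ (rotated⇔line k₂ o o′ b b′ d≤o o< d≤o′ o′<) (proj₂ p))
    , (λ p → refl , proj₂ (rotated⇔line k₂ o o′ b b′ d≤o o< d≤o′ o′<) (proj₂ p))
  twoCycles-adj⇔ (false , _ , _) (true  , _ , _) _ _ = (λ { (() , _) }) , (λ { (() , _) })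
  twoCycles-adj⇔ (true  , _ , _) (false , _ , _) _ _ = (λ { (() , _) }) , (λ { (() , _) })

  longCycle-adj⇔ : ∀ u v → InRange u → InRange v → Iff (Adj a (inLongCycle u) (inLongCycle v)) (BlockAdj u v)
  longCycle-adj⇔ (false , o , b) (false , o′ , b′) (d≤o , o<) (d≤o′ , o′<) =
      (λ p → refl , proj₁ (rotated⇔line L o o′ b b′ d≤o (<-≤-trans o< k₁≤L) d≤o′ (<-≤-trans o′< k₁≤L)) (proj₂ p))
    , (λ p → refl , proj₂ (rotated⇔line L o o′ b b′ d≤o (<-≤-trans o< k₁≤L) d≤o′ (<-≤-trans o′< k₁≤L)) (proj₂ p))
    where
    k₁≤L : k₁ ≤ L
    k₁≤L = m≤m+n k₁ k₂
  longCycle-adj⇔ (true , o , b) (true , o′ , b′) (d≤o , o<) (d≤o′ , o′<) =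
      (λ p → refl , proj₁ (LineAdj-shift k₁ o o′ b b′) (proj₁ shifted (proj₂ p)))
    , (λ p → refl , proj₂ shifted (proj₂ (LineAdj-shift k₁ o o′ b b′) (proj₂ p)))
    where
    shifted : Iff (FbarAdj a L ((k₁ + o + c) % L) b ((k₁ + o′ + c) % L) b′) (LineAdj (k₁ + o) b (k₁ + o′) b′)
    shifted = rotated⇔line L (k₁ + o) (k₁ + o′) b b′ (≤-trans d≤o (m≤n+m o k₁)) (+-monoʳ-< k₁ o<)
                                                      (≤-trans d≤o′ (m≤n+m o′ k₁)) (+-monoʳ-< k₁ o′<)
  longCycle-adj⇔ (false , o , b) (true , o′ , b′) (d≤o , o<) (d≤o′ , o′<) =
      (λ p → ⊥-elim (proj₁ (no-CycleAdj-across L k₁ o (k₁ + o′) b b′ d≤o o< (+-monoʳ-≤ k₁ d≤o′) (+-monoʳ-< k₁ o′<))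
                           (proj₁ (rotate⇔ L c o (k₁ + o′) b b′ (<-≤-trans o< (m≤m+n k₁ k₂)) (+-monoʳ-< k₁ o′<)) (proj₂ p))))
    , (λ { (() , _) })
  longCycle-adj⇔ (true , o , b) (false , o′ , b′) (d≤o , o<) (d≤o′ , o′<) =
      (λ p → ⊥-elim (proj₂ (no-CycleAdj-across L k₁ o′ (k₁ + o) b′ b d≤o′ o′< (+-monoʳ-≤ k₁ d≤o) (+-monoʳ-< k₁ o<))
                           (proj₁ (rotate⇔ L c (k₁ + o) o′ b b′ (+-monoʳ-< k₁ o<) (<-≤-trans o′< (m≤m+n k₁ k₂))) (proj₂ p))))
    , (λ { (() , _) })

  BlockIndep : ℕ → List BlockVertex → Set
  BlockIndep j Z = (length Z ≡ j) × AllPairs (λ u v → ¬ BlockAdj u v) Z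

  BlockIndep-↭ : ∀ {j Z Z′} → Z ↭ Z′ → BlockIndep j Z → BlockIndep j Z′
  BlockIndep-↭ Z↭Z′ (l , p) = trans (sym (Perm.↭-length Z↭Z′)) l
                            , AllPairs-↭ (λ {u} {v} ¬uv vu → ¬uv (BlockAdj-sym v u vu)) Z↭Z′ p

  embedded-indep⇔ : (f : BlockVertex → Vertex) → (∀ u v → InRange u → InRange v → Iff (Adj a (f u) (f v)) (BlockAdj u v)) →
    ∀ j Z → All InRange Z → Iff (IsIndepOfSize a j (map f Z)) (BlockIndep j Z)
  embedded-indep⇔ f f⇔ j Z inZ =
      (λ (l , p) → trans (sym (length-map f Z)) l
                 , AllPairs-mapWith inZ (λ {u} {v} iu iv ¬fuv uv → ¬fuv (proj₂ (f⇔ u v iu iv) uv)) (AllPairsₚ.map⁻ p))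
    , (λ (l , p) → trans (length-map f Z) l
                 , AllPairsₚ.map⁺ (AllPairs-mapWith inZ (λ {u} {v} iu iv ¬uv fuv → ¬uv (proj₁ (f⇔ u v iu iv) fuv)) p))

-- Convolution of counting sequences: conv f g n = Σ_{i + j = n} f i · g j.
conv : (ℕ → ℕ) → (ℕ → ℕ) → ℕ → ℕ
conv f g zero    = f 0 * g 0
conv f g (suc n) = f 0 * g (suc n) + conv (f ∘ suc) g n

conv-cong : ∀ (f f′ g g′ : ℕ → ℕ) n → (∀ i → i ≤ n → f i ≡ f′ i) → (∀ i → i ≤ n → g i ≡ g′ i) →
  conv f g n ≡ conv f′ g′ n
conv-cong f f′ g g′ zero    hf hg = cong₂ _*_ (hf 0 z≤n) (hg 0 z≤n)
conv-cong f f′ g g′ (suc n) hf hg = cong₂ _+_ (cong₂ _*_ (hf 0 z≤n) (hg (suc n) ≤-refl))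
  (conv-cong (f ∘ suc) (f′ ∘ suc) g g′ n (λ i i≤n → hf (suc i) (s≤s i≤n)) (λ i i≤n → hg i (m≤n⇒m≤1+n i≤n)))

conv-+ : ∀ (f h g : ℕ → ℕ) n → conv (λ i → f i + h i) g n ≡ conv f g n + conv h g n
conv-+ f h g zero    = *-distribʳ-+ (g 0) (f 0) (h 0)
conv-+ f h g (suc n) = begin
  (f 0 + h 0) * g (suc n) + conv (λ i → f (suc i) + h (suc i)) g n
    ≡⟨ cong₂ _+_ (*-distribʳ-+ (g (suc n)) (f 0) (h 0)) (conv-+ (f ∘ suc) (h ∘ suc) g n) ⟩
  (f 0 * g (suc n) + h 0 * g (suc n)) + (conv (f ∘ suc) g n + conv (h ∘ suc) g n)
    ≡⟨ interchange (f 0 * g (suc n)) (h 0 * g (suc n)) (conv (f ∘ suc) g n) (conv (h ∘ suc) g n) ⟩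
  (f 0 * g (suc n) + conv (f ∘ suc) g n) + (h 0 * g (suc n) + conv (h ∘ suc) g n) ∎
  where
  open ≡-Reasoning
  interchange : ∀ w x y z → (w + x) + (y + z) ≡ (w + y) + (x + z)
  interchange = solve-∀

conv-zero : ∀ (g : ℕ → ℕ) n → conv (λ _ → 0) g n ≡ 0
conv-zero g zero    = refl
conv-zero g (suc n) = conv-zero g n

conv-identity : ∀ (f g : ℕ → ℕ) n → f 0 ≡ 1 → (∀ i → f (suc i) ≡ 0) → conv f g n ≡ g n
conv-identity f g zero    f0≡1 _    = trans (cong (_* g 0) f0≡1) (+-identityʳ (g 0))
conv-identity f g (suc n) f0≡1 f+≡0 = trans
  (cong₂ _+_ (trans (cong (_* g (suc n)) f0≡1) (+-identityʳ (g (suc n))))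
             (trans (conv-cong (f ∘ suc) (λ _ → 0) g g n (λ i _ → f+≡0 i) (λ _ _ → refl)) (conv-zero g n)))
  (+-identityʳ (g (suc n)))

ifDec : {P : Set} → Dec P → ℕ → ℕ
ifDec (yes _) m = m
ifDec (no _)  m = 0

ifDec-cong : {P Q : Set} (p? : Dec P) (q? : Dec Q) → Iff P Q → ∀ {m m′} → m ≡ m′ → ifDec p? m ≡ ifDec q? m′
ifDec-cong (yes p) (yes q) P⇔Q e = e
ifDec-cong (yes p) (no ¬q) P⇔Q e = ⊥-elim (¬q (proj₁ P⇔Q p))
ifDec-cong (no ¬p) (yes q) P⇔Q e = ⊥-elim (¬p (proj₂ P⇔Q q))
ifDec-cong (no ¬p) (no ¬q) P⇔Q e = refl

conv-ifDec : {P : Set} (p? : Dec P) (h g : ℕ → ℕ) (n : ℕ) → conv (λ i → ifDec p? (h i)) g n ≡ ifDec p? (conv h g n)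
conv-ifDec (yes p) h g n = refl
conv-ifDec (no p)  h g n = conv-zero g n

Cross : {A : Set} → (A → A → Set) → List A → List A → Set
Cross R xs ys = All (λ x → All (R x) ys) xs

-- Counting independent sets by a recursion over the vertex list.  count-indep B n ys is the
-- number of n-element independent subsets of ys none of whose vertices is adjacent to a
-- vertex of the "blocked" list B; deciding on the head vertex y gives the recursion.
module Counting (a : List ℕ) where

  NonAdj : Vertex → Vertex → Set
  NonAdj u v = ¬ Adj a u v

  Unblocked : List Vertex → Vertex → Set
  Unblocked B y = All (λ b → NonAdj b y) B

  unblocked? : ∀ B y → Dec (Unblocked B y)
  unblocked? B y = all? (λ b → ¬? (Adj? a b y)) B

  count-indep : List Vertex → ℕ → List Vertex → ℕ
  count-indep B zero    ys       = 1
  count-indep B (suc n) []       = 0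
  count-indep B (suc n) (y ∷ ys) = count-indep B (suc n) ys + ifDec (unblocked? B y) (count-indep (y ∷ B) n ys)

  IndepAvoiding : List Vertex → ℕ → List Vertex → Set
  IndepAvoiding B n S = (length S ≡ n) × AllPairs NonAdj S × All (Unblocked B) S

  IndepAvoiding? : ∀ B n S → Dec (IndepAvoiding B n S)
  IndepAvoiding? B n S = (length S ≟ n) ×-dec (allPairs? (λ u v → ¬? (Adj? a u v)) S ×-dec all? (unblocked? B) S)

  IndepAvoiding-∷⇔ : ∀ B n y S → Iff (IndepAvoiding B (suc n) (y ∷ S)) (Unblocked B y × IndepAvoiding (y ∷ B) n S)
  IndepAvoiding-∷⇔ B n y S =
      (λ { (l , (py ∷ ps) , (oy ∷ os)) → oy , suc-injective l , ps , All.zipWith (λ { (p , q) → p ∷ q }) (py , os) })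
    , (λ { (oy , l , ps , os) → cong suc l , (All.map All.head os ∷ ps) , (oy ∷ All.map All.tail os) })

  count-indep-spec : ∀ B n ys → count (IndepAvoiding? B n) (sublists ys) ≡ count-indep B n ys
  count-indep-spec B zero    []       = refl
  count-indep-spec B (suc n) []       = refl
  count-indep-spec B zero    (y ∷ ys) = begin
    count (IndepAvoiding? B 0) (sublists ys ++ map (y ∷_) (sublists ys))
      ≡⟨ count-++ (IndepAvoiding? B 0) (sublists ys) _ ⟩
    count (IndepAvoiding? B 0) (sublists ys) + count (IndepAvoiding? B 0) (map (y ∷_) (sublists ys))
      ≡⟨ cong₂ _+_ (count-indep-spec B 0 ys)
                   (trans (count-map (IndepAvoiding? B 0) (y ∷_) (sublists ys))
                          (count-none _ (λ S g → 0≢1+n (sym (proj₁ g))) (sublists ys))) ⟩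
    1 ∎
    where open ≡-Reasoning
  count-indep-spec B (suc n) (y ∷ ys) = begin
    count (IndepAvoiding? B (suc n)) (sublists ys ++ map (y ∷_) (sublists ys))
      ≡⟨ count-++ (IndepAvoiding? B (suc n)) (sublists ys) _ ⟩
    count (IndepAvoiding? B (suc n)) (sublists ys) + count (IndepAvoiding? B (suc n)) (map (y ∷_) (sublists ys))
      ≡⟨ cong₂ _+_ (count-indep-spec B (suc n) ys)
                   (trans (count-map (IndepAvoiding? B (suc n)) (y ∷_) (sublists ys)) (with-y (unblocked? B y))) ⟩
    count-indep B (suc n) ys + ifDec (unblocked? B y) (count-indep (y ∷ B) n ys) ∎
    where
    open ≡-Reasoning
    with-y : (u? : Dec (Unblocked B y)) →
      count (λ S → IndepAvoiding? B (suc n) (y ∷ S)) (sublists ys) ≡ ifDec u? (count-indep (y ∷ B) n ys)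
    with-y (yes uy) = trans (count-cong (λ S → IndepAvoiding? B (suc n) (y ∷ S)) (IndepAvoiding? (y ∷ B) n)
                                        (λ S → proj₂ ∘ proj₁ (IndepAvoiding-∷⇔ B n y S) , proj₂ (IndepAvoiding-∷⇔ B n y S) ∘ (uy ,_))
                                        (sublists ys))
                            (count-indep-spec (y ∷ B) n ys)
    with-y (no ¬uy) = count-none _ (λ S g → ¬uy (proj₁ (proj₁ (IndepAvoiding-∷⇔ B n y S) g))) (sublists ys)

  count-sublists≡count-indep : ∀ n V → count (IsIndepOfSize? a n) (sublists V) ≡ count-indep [] n V
  count-sublists≡count-indep n V = trans
    (count-cong (IsIndepOfSize? a n) (IndepAvoiding? [] n)
                (λ S → (λ (l , p) → l , p , All.tabulate (λ _ → [])) , (λ (l , p , _) → l , p)) (sublists V))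
    (count-indep-spec [] n V)

  count-indep-unblock : ∀ B′ B n S → Cross NonAdj B S → count-indep (B′ ++ B) n S ≡ count-indep B′ n S
  count-indep-unblock B′ B zero    S       _ = refl
  count-indep-unblock B′ B (suc n) []      _ = refl
  count-indep-unblock B′ B (suc n) (y ∷ S) c = cong₂ _+_ (count-indep-unblock B′ B (suc n) S c′)
      (ifDec-cong (unblocked? (B′ ++ B) y) (unblocked? B′ y)
                  (Allₚ.++⁻ˡ B′ , (λ u → Allₚ.++⁺ u (All.map All.head c)))
                  (count-indep-unblock (y ∷ B′) B n S c′))
    where
    c′ : Cross NonAdj B S
    c′ = All.map All.tail c

  count-indep-++ : ∀ B X S n → Cross NonAdj X S → Cross NonAdj B S →
    count-indep B n (X ++ S) ≡ conv (λ i → count-indep B i X) (λ i → count-indep [] i S) n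
  count-indep-++ B [] S n _ cB = sym (trans
    (conv-identity (λ i → count-indep B i []) (λ i → count-indep [] i S) n refl (λ i → refl))
    (sym (count-indep-unblock [] B n S cB)))
  count-indep-++ B (x ∷ X) S zero    _          _  = refl
  count-indep-++ B (x ∷ X) S (suc n) (cx ∷ cX) cB = begin
    count-indep B (suc n) (X ++ S) + ifDec (unblocked? B x) (count-indep (x ∷ B) n (X ++ S))
      ≡⟨ cong₂ _+_ (count-indep-++ B X S (suc n) cX cB)
                   (cong (ifDec (unblocked? B x)) (count-indep-++ (x ∷ B) X S n cX (cx ∷ cB))) ⟩
    (1 * g (suc n) + conv (λ i → count-indep B (suc i) X) g n) + ifDec (unblocked? B x) (conv (λ i → count-indep (x ∷ B) i X) g n)
      ≡⟨ +-assoc (1 * g (suc n)) _ _ ⟩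
    1 * g (suc n) + (conv (λ i → count-indep B (suc i) X) g n + ifDec (unblocked? B x) (conv (λ i → count-indep (x ∷ B) i X) g n))
      ≡⟨ cong (λ t → 1 * g (suc n) + (conv (λ i → count-indep B (suc i) X) g n + t))
              (sym (conv-ifDec (unblocked? B x) (λ i → count-indep (x ∷ B) i X) g n)) ⟩
    1 * g (suc n) + (conv (λ i → count-indep B (suc i) X) g n + conv (λ i → ifDec (unblocked? B x) (count-indep (x ∷ B) i X)) g n)
      ≡⟨ cong (1 * g (suc n) +_) (sym (conv-+ (λ i → count-indep B (suc i) X) (λ i → ifDec (unblocked? B x) (count-indep (x ∷ B) i X)) g n)) ⟩
    conv (λ i → count-indep B i (x ∷ X)) g (suc n) ∎
    where
    open ≡-Reasoning
    g : ℕ → ℕ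
    g i = count-indep [] i S

  count-indep-relabel : ∀ {T : Set} (f g : T → Vertex) → (∀ p q → Iff (Adj a (f p) (f q)) (Adj a (g p) (g q))) →
    ∀ B n xs → count-indep (map f B) n (map f xs) ≡ count-indep (map g B) n (map g xs)
  count-indep-relabel f g f⇔g B zero    xs       = refl
  count-indep-relabel f g f⇔g B (suc n) []       = refl
  count-indep-relabel f g f⇔g B (suc n) (y ∷ xs) = cong₂ _+_ (count-indep-relabel f g f⇔g B (suc n) xs)
    (ifDec-cong (unblocked? (map f B) (f y)) (unblocked? (map g B) (g y))
      ( (λ u → Allₚ.map⁺ (All.map (λ {p} na adj → na (proj₂ (f⇔g p y) adj)) (Allₚ.map⁻ u)))
      , (λ u → Allₚ.map⁺ (All.map (λ {p} na adj → na (proj₁ (f⇔g p y) adj)) (Allₚ.map⁻ u))))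
      (count-indep-relabel f g f⇔g (y ∷ B) n xs))

  All-comp-compVertices : ∀ i k → All (λ v → comp v ≡ i) (compVertices i k)
  All-comp-compVertices i k rewrite compVertices≡ i k =
    All-pendantPairs (vtx i k) (range 0 k) (λ _ _ → refl) (All-range 0 k)

  All-comp-unionVertices : ∀ j ks → All (λ v → j ≤ comp v) (unionVertices j ks)
  All-comp-unionVertices j []       = []
  All-comp-unionVertices j (k ∷ ks) = Allₚ.++⁺ (All.map (λ e → ≤-reflexive (sym e)) (All-comp-compVertices j k))
                                              (All.map (≤-trans (n≤1+n j)) (All-comp-unionVertices (suc j) ks))

  Cross-components : ∀ j X S → All (λ v → comp v < j) X → All (λ v → j ≤ comp v) S → Cross NonAdj X S
  Cross-components j X S X<j j≤S = All.map (λ lt → All.map (λ le adj → <⇒≢ (<-≤-trans lt le) (proj₁ adj)) j≤S) X<j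

  Cross-first-component : ∀ i k ks → Cross NonAdj (compVertices i k) (unionVertices (suc i) ks)
  Cross-first-component i k ks = Cross-components (suc i) _ _
    (All.map (λ e → ≤-reflexive (cong suc e)) (All-comp-compVertices i k)) (All-comp-unionVertices (suc i) ks)

  count-compVertices-relabel : ∀ i j k m → count-indep [] m (compVertices i k) ≡ count-indep [] m (compVertices j k)
  count-compVertices-relabel i j k m rewrite compVertices≡ i k | compVertices≡ j k =
    trans (cong (count-indep [] m) (sym (map-pendantPairs (relabel i) (_,_) (range 0 k))))
          (trans (count-indep-relabel (relabel i) (relabel j) (λ p q → (λ adj → refl , proj₂ adj) , (λ adj → refl , proj₂ adj)) [] m _)
                 (cong (count-indep [] m) (map-pendantPairs (relabel j) (_,_) (range 0 k))))
    where
    relabel : ℕ → ℕ × Bool → Vertex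
    relabel i (x , b) = vtx i k x b

  count-unionVertices-relabel : ∀ ks i j m → count-indep [] m (unionVertices i ks) ≡ count-indep [] m (unionVertices j ks)
  count-unionVertices-relabel []       i j m = refl
  count-unionVertices-relabel (k ∷ ks) i j m = begin
    count-indep [] m (compVertices i k ++ unionVertices (suc i) ks)
      ≡⟨ count-indep-++ [] (compVertices i k) _ m (Cross-first-component i k ks) [] ⟩
    conv (λ t → count-indep [] t (compVertices i k)) (λ t → count-indep [] t (unionVertices (suc i) ks)) m
      ≡⟨ conv-cong _ _ _ _ m (λ t _ → count-compVertices-relabel i j k t)
                             (λ t _ → count-unionVertices-relabel ks (suc i) (suc j) t) ⟩
    conv (λ t → count-indep [] t (compVertices j k)) (λ t → count-indep [] t (unionVertices (suc j) ks)) m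
      ≡⟨ sym (count-indep-++ [] (compVertices j k) _ m (Cross-first-component j k ks) []) ⟩
    count-indep [] m (compVertices j k ++ unionVertices (suc j) ks) ∎
    where open ≡-Reasoning

  Merging : ℕ → ℕ → Set
  Merging n K = ∀ k₁ k₂ → K ≤ k₁ → K ≤ k₂ → ∀ j → j ≤ n →
    count-indep [] j (compVertices 0 k₁ ++ compVertices 1 k₂) ≡ count-indep [] j (compVertices 0 (k₁ + k₂))

  -- Merging the first two components of a disjoint union preserves the count: the remaining
  -- components enter through a convolution with the same counts of smaller sets.
  merge-first-two : ∀ n k₁ k₂ rest →
    (∀ j → j ≤ n → count-indep [] j (compVertices 0 k₁ ++ compVertices 1 k₂) ≡ count-indep [] j (compVertices 0 (k₁ + k₂))) →
    count-indep [] n (unionVertices 0 (k₁ ∷ k₂ ∷ rest)) ≡ count-indep [] n (unionVertices 0 (k₁ + k₂ ∷ rest))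
  merge-first-two n k₁ k₂ rest merge₂ = begin
    count-indep [] n (compVertices 0 k₁ ++ (compVertices 1 k₂ ++ unionVertices 2 rest))
      ≡⟨ cong (count-indep [] n) (sym (++-assoc (compVertices 0 k₁) _ _)) ⟩
    count-indep [] n ((compVertices 0 k₁ ++ compVertices 1 k₂) ++ unionVertices 2 rest)
      ≡⟨ count-indep-++ [] _ _ n (Cross-components 2 _ _ first-two<2 (All-comp-unionVertices 2 rest)) [] ⟩
    conv (λ t → count-indep [] t (compVertices 0 k₁ ++ compVertices 1 k₂)) (λ t → count-indep [] t (unionVertices 2 rest)) n
      ≡⟨ conv-cong _ _ _ _ n merge₂ (λ t _ → count-unionVertices-relabel rest 2 1 t) ⟩
    conv (λ t → count-indep [] t (compVertices 0 (k₁ + k₂))) (λ t → count-indep [] t (unionVertices 1 rest)) n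
      ≡⟨ sym (count-indep-++ [] _ _ n (Cross-first-component 0 (k₁ + k₂) rest) []) ⟩
    count-indep [] n (compVertices 0 (k₁ + k₂) ++ unionVertices 1 rest) ∎
    where
    open ≡-Reasoning
    first-two<2 : All (λ v → comp v < 2) (compVertices 0 k₁ ++ compVertices 1 k₂)
    first-two<2 = Allₚ.++⁺ (All.map (λ e → subst (_< 2) (sym e) (s≤s z≤n)) (All-comp-compVertices 0 k₁))
                           (All.map (λ e → subst (_< 2) (sym e) (s≤s (s≤s z≤n))) (All-comp-compVertices 1 k₂))

  collapse : ∀ {n K} → Merging n K → ∀ ks k → K ≤ k → All (K ≤_) ks →
    count-indep [] n (unionVertices 0 (k ∷ ks)) ≡ count-indep [] n (unionVertices 0 (k + sum ks ∷ []))
  collapse {n} merging []        k _   _          =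
    cong (λ t → count-indep [] n (unionVertices 0 (t ∷ []))) (sym (+-identityʳ k))
  collapse {n} merging (k₂ ∷ ks) k K≤k (K≤k₂ ∷ ps) = begin
    count-indep [] n (unionVertices 0 (k ∷ k₂ ∷ ks))
      ≡⟨ merge-first-two n k k₂ ks (merging k k₂ K≤k K≤k₂) ⟩
    count-indep [] n (unionVertices 0 (k + k₂ ∷ ks))
      ≡⟨ collapse merging ks (k + k₂) (≤-trans K≤k (m≤m+n k k₂)) ps ⟩
    count-indep [] n (unionVertices 0 (k + k₂ + sum ks ∷ []))
      ≡⟨ cong (λ t → count-indep [] n (unionVertices 0 (t ∷ []))) (+-assoc k k₂ (sum ks)) ⟩
    count-indep [] n (unionVertices 0 (k + (k₂ + sum ks) ∷ [])) ∎
    where open ≡-Reasoning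

  -- Hence the count depends only on the total size (for a positive threshold K, the empty
  -- list is the only list of sum 0).
  indepCount-depends-on-sum : ∀ {n K} → 1 ≤ K → Merging n K → (ks ks′ : List ℕ) → All (K ≤_) ks → All (K ≤_) ks′ →
    sum ks ≡ sum ks′ → indepCount a n ks ≡ indepCount a n ks′
  indepCount-depends-on-sum _ _ [] [] _ _ _ = refl
  indepCount-depends-on-sum 1≤K _ [] (k ∷ ks′) _ (K≤k ∷ _) e = ⊥-elim (<⇒≢ (<-≤-trans 1≤K (≤-trans K≤k (m≤m+n k (sum ks′)))) e)
  indepCount-depends-on-sum 1≤K _ (k ∷ ks) [] (K≤k ∷ _) _ e = ⊥-elim (<⇒≢ (<-≤-trans 1≤K (≤-trans K≤k (m≤m+n k (sum ks)))) (sym e))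
  indepCount-depends-on-sum {n} _ merging (k ∷ ks) (k′ ∷ ks′) (K≤k ∷ ps) (K≤k′ ∷ ps′) e = begin
    indepCount a n (k ∷ ks)                              ≡⟨ count-sublists≡count-indep n _ ⟩
    count-indep [] n (unionVertices 0 (k ∷ ks))          ≡⟨ collapse merging ks k K≤k ps ⟩
    count-indep [] n (unionVertices 0 (k + sum ks ∷ [])) ≡⟨ cong (λ t → count-indep [] n (unionVertices 0 (t ∷ []))) e ⟩
    count-indep [] n (unionVertices 0 (k′ + sum ks′ ∷ [])) ≡⟨ sym (collapse merging ks′ k′ K≤k′ ps′) ⟩
    count-indep [] n (unionVertices 0 (k′ ∷ ks′))        ≡⟨ sym (count-sublists≡count-indep n _) ⟩
    indepCount a n (k′ ∷ ks′)                            ∎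
    where open ≡-Reasoning

-- Searching a mask for a zero window: the first of t consecutive blocks of w bits that is
-- entirely false.  If there is none, each block has a true bit, so the weight is ≥ t.
module WindowSearch (w : ℕ) where

  ZeroWindow : List Bool → Set
  ZeroWindow ℓ = w ≤ length ℓ × All (_≡ false) (take w ℓ)

  zeroWindow? : ∀ ℓ → Dec (ZeroWindow ℓ)
  zeroWindow? ℓ = (w ≤? length ℓ) ×-dec all? (λ b → b Bool.≟ false) (take w ℓ)

  hereOrLater : ∀ {P : Set} → Dec P → Maybe ℕ → Maybe ℕ
  hereOrLater (yes _) _ = just 0
  hereOrLater (no _)  r = Maybe.map suc r

  firstZeroWindow : ℕ → List Bool → Maybe ℕ
  firstZeroWindow zero    ℓ = nothing
  firstZeroWindow (suc t) ℓ = hereOrLater (zeroWindow? ℓ) (firstZeroWindow t (drop w ℓ))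

  firstZeroWindow-just : ∀ t ℓ i → firstZeroWindow t ℓ ≡ just i → i < t × ZeroWindow (drop (i * w) ℓ)
  firstZeroWindow-just (suc t) ℓ i e with zeroWindow? ℓ | firstZeroWindow t (drop w ℓ) in eq
  firstZeroWindow-just (suc t) ℓ .0 refl | yes zw | _ = s≤s z≤n , zw
  firstZeroWindow-just (suc t) ℓ .(suc i) refl | no _ | just i with firstZeroWindow-just t (drop w ℓ) i eq
  ... | (i<t , zw) = s≤s i<t , subst ZeroWindow (drop-drop w (i * w) ℓ) zw
  firstZeroWindow-just (suc t) ℓ i () | no _ | nothing

  firstZeroWindow-nothing : ∀ t ℓ → firstZeroWindow t ℓ ≡ nothing → t * w ≤ length ℓ → t ≤ weight ℓ
  firstZeroWindow-nothing zero    ℓ e le = z≤n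
  firstZeroWindow-nothing (suc t) ℓ e le with zeroWindow? ℓ | firstZeroWindow t (drop w ℓ) in eq
  firstZeroWindow-nothing (suc t) ℓ () le | yes _ | _
  firstZeroWindow-nothing (suc t) ℓ () le | no _  | just _
  firstZeroWindow-nothing (suc t) ℓ e  le | no ¬zw | nothing = begin
    suc t                                 ≤⟨ +-mono-≤ first-block rest ⟩
    weight (take w ℓ) + weight (drop w ℓ) ≡⟨ sym (weight-take-drop w ℓ) ⟩
    weight ℓ                              ∎
    where
    open ≤-Reasoning
    first-block : 1 ≤ weight (take w ℓ)
    first-block = weight-pos (take w ℓ) (λ zs → ¬zw (≤-trans (m≤m+n w (t * w)) le , zs))
    rest : t ≤ weight (drop w ℓ)
    rest = firstZeroWindow-nothing t (drop w ℓ) eq (subst (t * w ≤_) (sym (length-drop w ℓ))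
             (subst (_≤ length ℓ ∸ w) (m+n∸m≡n w (t * w)) (∸-monoˡ-≤ w le)))

-- The exchange involution on masks m = m₁ ++ m₂ of the vertex list of two cycles, |m₁| = B₁
-- (two bits per position, so windows of d positions have d + d bits).  Look for the first
-- window, among T, that is zero in the profile m₁ ∨ m₂ (i.e. in both masks); if it starts
-- at position c, exchange the prefixes of c positions of m₁ and m₂.  The profile, and hence
-- the window found, is unchanged, so this is an involution.
module Exchange (d B₁ : ℕ) where
  open WindowSearch (d + d)

  firstHalf secondHalf : List Bool → List Bool
  firstHalf  m = take B₁ m
  secondHalf m = drop B₁ m

  profile : List Bool → List Bool
  profile m = zipWith _∨_ (firstHalf m) (secondHalf m)

  exchangePrefixes : ℕ → List Bool → List Bool
  exchangePrefixes c m = (take (c + c) (secondHalf m) ++ drop (c + c) (firstHalf m))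
                      ++ (take (c + c) (firstHalf m) ++ drop (c + c) (secondHalf m))

  exchangeAt : List Bool → Maybe ℕ → List Bool
  exchangeAt m nothing  = m
  exchangeAt m (just i) = exchangePrefixes (i * d) m

  exchange : ℕ → List Bool → List Bool
  exchange T m = exchangeAt m (firstZeroWindow T (profile m))

  prefix window tail : ℕ → List Bool → List Bool
  prefix c x = take (c + c) x
  window c x = take (d + d) (drop (c + c) x)
  tail   c x = drop (d + d) (drop (c + c) x)

  pieces : ∀ c x → x ≡ prefix c x ++ window c x ++ tail c x
  pieces c x = trans (sym (take++drop≡id (c + c) x)) (cong (prefix c x ++_) (sym (take++drop≡id (d + d) (drop (c + c) x))))

  length-pieces : ∀ c e k → c + d + e ≡ k → ∀ x → length x ≡ k + k →
    (length (prefix c x) ≡ c + c) × (length (window c x) ≡ d + d) × (length (tail c x) ≡ e + e)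
  length-pieces c e k k≡ x |x|′ =
      length-take-≤ (c + c) x (subst (c + c ≤_) (sym |x|) (m≤m+n (c + c) _))
    , length-take-≤ (d + d) (drop (c + c) x) (subst (d + d ≤_) (sym |rest|) (m≤m+n (d + d) _))
    , trans (length-drop (d + d) (drop (c + c) x)) (trans (cong (_∸ (d + d)) |rest|) (m+n∸m≡n (d + d) (e + e)))
    where
    regroup : ∀ c d e → (c + d + e) + (c + d + e) ≡ (c + c) + ((d + d) + (e + e))
    regroup = solve-∀
    |x| : length x ≡ (c + c) + ((d + d) + (e + e))
    |x| = trans |x|′ (trans (cong₂ _+_ (sym k≡) (sym k≡)) (regroup c d e))
    |rest| : length (drop (c + c) x) ≡ (d + d) + (e + e)
    |rest| = trans (length-drop (c + c) x) (trans (cong (_∸ (c + c)) |x|) (m+n∸m≡n (c + c) _))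

  mask-pieces : ∀ c m → m ≡ prefix c (firstHalf m) ++ window c (firstHalf m) ++ tail c (firstHalf m)
                          ++ prefix c (secondHalf m) ++ window c (secondHalf m) ++ tail c (secondHalf m)
  mask-pieces c m = trans (sym (take++drop≡id B₁ m))
    (trans (cong₂ _++_ (pieces c (firstHalf m)) (pieces c (secondHalf m)))
           (++-assoc₃ (prefix c (firstHalf m)) (window c (firstHalf m)) (tail c (firstHalf m)) _))

  exchanged-pieces : ∀ c m → exchangePrefixes c m ≡ prefix c (secondHalf m) ++ window c (firstHalf m) ++ tail c (firstHalf m)
                                                    ++ prefix c (firstHalf m) ++ window c (secondHalf m) ++ tail c (secondHalf m)
  exchanged-pieces c m =
    trans (cong₂ _++_ (cong (prefix c (secondHalf m) ++_) (sym (take++drop≡id (d + d) (drop (c + c) (firstHalf m)))))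
                      (cong (prefix c (firstHalf m) ++_) (sym (take++drop≡id (d + d) (drop (c + c) (secondHalf m))))))
          (++-assoc₃ (prefix c (secondHalf m)) (window c (firstHalf m)) (tail c (firstHalf m)) _)

  module _ (B₂ : ℕ) where

    length-firstHalf : ∀ m → length m ≡ B₁ + B₂ → length (firstHalf m) ≡ B₁
    length-firstHalf m lm = length-take-≤ B₁ m (subst (B₁ ≤_) (sym lm) (m≤m+n B₁ B₂))

    length-secondHalf : ∀ m → length m ≡ B₁ + B₂ → length (secondHalf m) ≡ B₂
    length-secondHalf m lm = trans (length-drop B₁ m) (trans (cong (_∸ B₁) lm) (m+n∸m≡n B₁ B₂))

    module _ (m : List Bool) (lm : length m ≡ B₁ + B₂) (c : ℕ) (h₁ : c + c ≤ B₁) (h₂ : c + c ≤ B₂) where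
      private
        cc : ℕ
        cc = c + c
        m₁ m₂ y₁ y₂ : List Bool
        m₁ = firstHalf m
        m₂ = secondHalf m
        y₁ = take cc m₂ ++ drop cc m₁
        y₂ = take cc m₁ ++ drop cc m₂
        |take-m₁| : length (take cc m₁) ≡ cc
        |take-m₁| = length-take-≤ cc m₁ (subst (cc ≤_) (sym (length-firstHalf m lm)) h₁)
        |take-m₂| : length (take cc m₂) ≡ cc
        |take-m₂| = length-take-≤ cc m₂ (subst (cc ≤_) (sym (length-secondHalf m lm)) h₂)
        |y₁| : length y₁ ≡ B₁
        |y₁| = trans (length-++ (take cc m₂))
                     (trans (cong₂ _+_ |take-m₂| (trans (length-drop cc m₁) (cong (_∸ cc) (length-firstHalf m lm)))) (m+[n∸m]≡n h₁))
        |y₂| : length y₂ ≡ B₂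
        |y₂| = trans (length-++ (take cc m₁))
                     (trans (cong₂ _+_ |take-m₁| (trans (length-drop cc m₂) (cong (_∸ cc) (length-secondHalf m lm)))) (m+[n∸m]≡n h₂))
        firstHalf-exchanged : firstHalf (exchangePrefixes c m) ≡ y₁
        firstHalf-exchanged = take-length-++ y₁ y₂ B₁ |y₁|
        secondHalf-exchanged : secondHalf (exchangePrefixes c m) ≡ y₂
        secondHalf-exchanged = drop-length-++ y₁ y₂ B₁ |y₁|

      exchangePrefixes-length : length (exchangePrefixes c m) ≡ B₁ + B₂
      exchangePrefixes-length = trans (length-++ y₁) (cong₂ _+_ |y₁| |y₂|)

      exchangePrefixes-profile : profile (exchangePrefixes c m) ≡ profile m
      exchangePrefixes-profile = begin
        zipWith _∨_ (firstHalf (exchangePrefixes c m)) (secondHalf (exchangePrefixes c m))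
          ≡⟨ cong₂ (zipWith _∨_) firstHalf-exchanged secondHalf-exchanged ⟩
        zipWith _∨_ y₁ y₂
          ≡⟨ zipWith-++ (take cc m₂) (take cc m₁) (drop cc m₁) (drop cc m₂) (trans |take-m₂| (sym |take-m₁|)) ⟩
        zipWith _∨_ (take cc m₂) (take cc m₁) ++ zipWith _∨_ (drop cc m₁) (drop cc m₂)
          ≡⟨ cong (_++ zipWith _∨_ (drop cc m₁) (drop cc m₂)) (zipWith-comm _∨_ ∨-comm (take cc m₂) (take cc m₁)) ⟩
        zipWith _∨_ (take cc m₁) (take cc m₂) ++ zipWith _∨_ (drop cc m₁) (drop cc m₂)
          ≡⟨ sym (zipWith-++ (take cc m₁) (take cc m₂) (drop cc m₁) (drop cc m₂) (trans |take-m₁| (sym |take-m₂|))) ⟩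
        zipWith _∨_ (take cc m₁ ++ drop cc m₁) (take cc m₂ ++ drop cc m₂)
          ≡⟨ cong₂ (zipWith _∨_) (take++drop≡id cc m₁) (take++drop≡id cc m₂) ⟩
        zipWith _∨_ m₁ m₂ ∎
        where open ≡-Reasoning

      exchangePrefixes-involutive : exchangePrefixes c (exchangePrefixes c m) ≡ m
      exchangePrefixes-involutive = begin
        exchangePrefixes c (exchangePrefixes c m)
          ≡⟨ cong₂ (λ u v → (take cc v ++ drop cc u) ++ (take cc u ++ drop cc v)) firstHalf-exchanged secondHalf-exchanged ⟩
        (take cc y₂ ++ drop cc y₁) ++ (take cc y₁ ++ drop cc y₂)
          ≡⟨ cong₂ _++_ (cong₂ _++_ (take-length-++ (take cc m₁) (drop cc m₂) cc |take-m₁|)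
                                     (drop-length-++ (take cc m₂) (drop cc m₁) cc |take-m₂|))
                        (cong₂ _++_ (take-length-++ (take cc m₂) (drop cc m₁) cc |take-m₂|)
                                     (drop-length-++ (take cc m₁) (drop cc m₂) cc |take-m₁|)) ⟩
        (take cc m₁ ++ drop cc m₁) ++ (take cc m₂ ++ drop cc m₂)
          ≡⟨ cong₂ _++_ (take++drop≡id cc m₁) (take++drop≡id cc m₂) ⟩
        m₁ ++ m₂
          ≡⟨ take++drop≡id B₁ m ⟩
        m ∎
        where open ≡-Reasoning

    module _ (T : ℕ) (H₁ : T * (d + d) ≤ B₁) (H₂ : T * (d + d) ≤ B₂) where

      window-fits : ∀ i → i < T → (i * d + i * d) + (d + d) ≤ B₁ × (i * d + i * d) + (d + d) ≤ B₂
      window-fits i i<T = ≤-trans le H₁ , ≤-trans le H₂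
        where
        le : (i * d + i * d) + (d + d) ≤ T * (d + d)
        le = subst (_≤ T * (d + d)) (sym (trans (cong (_+ (d + d)) (sym (*-distribˡ-+ i d d))) (+-comm (i * (d + d)) (d + d))))
                   (*-monoˡ-≤ (d + d) i<T)

      prefix-fits : ∀ i → i < T → (i * d + i * d ≤ B₁) × (i * d + i * d ≤ B₂)
      prefix-fits i i<T = ≤-trans (m≤m+n _ (d + d)) (proj₁ (window-fits i i<T))
                        , ≤-trans (m≤m+n _ (d + d)) (proj₂ (window-fits i i<T))

      exchange-involutive : ∀ m → length m ≡ B₁ + B₂ → exchange T (exchange T m) ≡ m
      exchange-involutive m lm with firstZeroWindow T (profile m) in eq
      ... | nothing rewrite eq = refl
      ... | just i with firstZeroWindow-just T (profile m) i eq
      ... | (i<T , _) = begin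
        exchangeAt (exchangePrefixes c m) (firstZeroWindow T (profile (exchangePrefixes c m)))
          ≡⟨ cong (λ t → exchangeAt (exchangePrefixes c m) (firstZeroWindow T t)) (exchangePrefixes-profile m lm c h₁ h₂) ⟩
        exchangeAt (exchangePrefixes c m) (firstZeroWindow T (profile m))
          ≡⟨ cong (exchangeAt (exchangePrefixes c m)) eq ⟩
        exchangePrefixes c (exchangePrefixes c m)
          ≡⟨ exchangePrefixes-involutive m lm c h₁ h₂ ⟩
        m ∎
        where
        open ≡-Reasoning
        c : ℕ
        c = i * d
        h₁ : c + c ≤ B₁
        h₁ = proj₁ (prefix-fits i i<T)
        h₂ : c + c ≤ B₂
        h₂ = proj₂ (prefix-fits i i<T)

      exchange-length : ∀ m → length m ≡ B₁ + B₂ → length (exchange T m) ≡ B₁ + B₂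
      exchange-length m lm with firstZeroWindow T (profile m) in eq
      ... | nothing = lm
      ... | just i with firstZeroWindow-just T (profile m) i eq
      ... | (i<T , _) = exchangePrefixes-length m lm (i * d) (proj₁ (prefix-fits i i<T)) (proj₂ (prefix-fits i i<T))

      data ExchangeView (m : List Bool) : Set where
        heavy : exchange T m ≡ m → T ≤ weight m → ExchangeView m
        at    : ∀ i → i < T → exchange T m ≡ exchangePrefixes (i * d) m →
                All (_≡ false) (take (d + d) (drop (i * d + i * d) (firstHalf m))) →
                All (_≡ false) (take (d + d) (drop (i * d + i * d) (secondHalf m))) → ExchangeView m

      exchangeView : ∀ m → length m ≡ B₁ + B₂ → ExchangeView m
      exchangeView m lm with firstZeroWindow T (profile m) in eq
      ... | nothing = heavy (cong (exchangeAt m) eq) (begin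
        T                                          ≤⟨ firstZeroWindow-nothing T (profile m) eq T-windows-fit ⟩
        weight (profile m)                         ≤⟨ weight-∨ (firstHalf m) (secondHalf m) ⟩
        weight (firstHalf m) + weight (secondHalf m) ≡⟨ sym (weight-take-drop B₁ m) ⟩
        weight m                                   ∎)
        where
        open ≤-Reasoning
        T-windows-fit : T * (d + d) ≤ length (profile m)
        T-windows-fit = subst (T * (d + d) ≤_)
          (sym (trans (length-zipWith _∨_ (firstHalf m) (secondHalf m)) (cong₂ _⊓_ (length-firstHalf m lm) (length-secondHalf m lm))))
          (⊓-glb H₁ H₂)
      ... | just i with firstZeroWindow-just T (profile m) i eq
      ... | (i<T , (_ , zero-window)) = at i i<T (cong (exchangeAt m) eq) (proj₁ both-zero) (proj₂ both-zero)
        where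
        cc : ℕ
        cc = i * d + i * d
        zero-or : All (_≡ false) (zipWith _∨_ (take (d + d) (drop cc (firstHalf m))) (take (d + d) (drop cc (secondHalf m))))
        zero-or = subst (All (_≡ false))
          (trans (cong (λ t → take (d + d) (drop t (profile m))) (*-distribˡ-+ i d d))
                 (trans (cong (take (d + d)) (drop-zipWith cc (firstHalf m) (secondHalf m))) (take-zipWith (d + d) _ _)))
          zero-window
        window-length : ∀ B (x : List Bool) → length x ≡ B → cc + (d + d) ≤ B → length (take (d + d) (drop cc x)) ≡ d + d
        window-length B x lx le = length-take-≤ (d + d) _ (subst ((d + d) ≤_) (sym (trans (length-drop cc x) (cong (_∸ cc) lx)))
                                    (subst (_≤ B ∸ cc) (m+n∸m≡n cc (d + d)) (∸-monoˡ-≤ cc le)))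
        both-zero : All (_≡ false) (take (d + d) (drop cc (firstHalf m))) × All (_≡ false) (take (d + d) (drop cc (secondHalf m)))
        both-zero = ∨-false⁻ _ _ (trans (window-length B₁ (firstHalf m) (length-firstHalf m lm) (proj₁ (window-fits i i<T)))
                                        (sym (window-length B₂ (secondHalf m) (length-secondHalf m lm) (proj₂ (window-fits i i<T)))))
                             zero-or

-- Write k₁ = c + d + e₁, k₂ = c + d + e₂.
-- Cycle s consists of a prefix [0, c), a window [c, c + d) and a tail [c + d, k_s); the long
-- cycle of length L = k₁ + k₂ consists of the six segments [0, c), [c, c + d), [c + d, k₁),
-- [k₁, k₁ + c), [k₁ + c, k₁ + c + d), [k₁ + c + d, L).  In the block coordinates of TwoBlocks
-- (rotation by c), the prefix and tail of cycle s are the blocks of offsets [d + e_s, d + e_s + c)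
-- and [d, d + e_s); in the long cycle the tail of cycle 1, the prefix of cycle 1, the prefix of
-- cycle 2 and the tail of cycle 2 occupy the third, fourth, first and sixth segments.
module Decomposition (a : List ℕ) (d : ℕ) (a≤d : All (_≤ d) a) (c e₁ e₂ : ℕ)
  {{_ : NonZero (c + d + e₁)}} {{_ : NonZero (c + d + e₂)}} {{_ : NonZero ((c + d + e₁) + (c + d + e₂))}} where
  open TwoBlocks a d a≤d (c + d + e₁) (c + d + e₂) c

  k₁ k₂ : ℕ
  k₁ = c + d + e₁
  k₂ = c + d + e₂

  block : Bool → ℕ → ℕ → List BlockVertex
  block s start n = pendantPairs (λ o b → (s , o , b)) (range start n)

  segment : ℕ → ℕ → ℕ → ℕ → List Vertex
  segment i k start n = pendantPairs (vtx i k) (range start n)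

  length-segment : ∀ i k start n → length (segment i k start n) ≡ n + n
  length-segment i k start n = trans (length-pendantPairs (vtx i k) (range start n))
                                     (cong₂ _+_ (length-range start n) (length-range start n))

  placed : ∀ i k (h : ℕ → ℕ) src tgt n → (∀ j → j < n → h (src + j) ≡ tgt + j) →
    pendantPairs (λ o b → vtx i k (h o) b) (range src n) ≡ segment i k tgt n
  placed i k h src tgt n h≡ = trans (sym (pendantPairs-map (vtx i k) h (range src n)))
                                    (cong (pendantPairs (vtx i k)) (map-range h src tgt n h≡))

  block-inRange : ∀ s start n → d ≤ start → start + n ≤ blockSize s → All InRange (block s start n)
  block-inRange s start n d≤ ≤k = All-pendantPairs _ (range start n) (λ _ p → p)
    (All.map (λ (s≤o , o<) → ≤-trans d≤ s≤o , <-≤-trans o< ≤k) (All-range start n))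

  -- Where the blocks land: positions are reduced modulo the cycle length, wrapping around
  -- once for prefixes.
  private
    wraps : ∀ x j K .{{_ : NonZero K}} → x ≡ j + K → j < K → x % K ≡ j
    wraps x j K x≡ j<K = trans (cong (_% K) x≡) (trans ([m+n]%n≡m%n j K) (m<n⇒m%n≡m j<K))

    stays : ∀ x y K .{{_ : NonZero K}} → x ≡ y → y < K → x % K ≡ y
    stays x y K x≡ y<K = trans (cong (_% K) x≡) (m<n⇒m%n≡m y<K)

    prefix-end≡ : ∀ c d e → d + e + c ≡ c + d + e
    prefix-end≡ = solve-∀
    prefix-own≡ : ∀ c d e j → d + e + j + c ≡ j + (c + d + e)
    prefix-own≡ = solve-∀
    tail-own≡ : ∀ c d j → d + j + c ≡ c + d + j
    tail-own≡ = solve-∀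
    prefix₁-long≡ : ∀ c d e₁ j → d + e₁ + j + c ≡ (c + d + e₁) + j
    prefix₁-long≡ = solve-∀
    prefix₂-long≡ : ∀ c d e₁ e₂ j → (c + d + e₁) + (d + e₂ + j) + c ≡ j + ((c + d + e₁) + (c + d + e₂))
    prefix₂-long≡ = solve-∀
    tail₂-long≡ : ∀ c d e₁ j → (c + d + e₁) + (d + j) + c ≡ (c + d + e₁) + (c + d) + j
    tail₂-long≡ = solve-∀

    c≤k : ∀ e → c ≤ c + d + e
    c≤k e = ≤-trans (m≤m+n c d) (m≤m+n (c + d) e)

    tail< : ∀ e j → j < e → c + d + j < c + d + e
    tail< e j j<e = +-monoʳ-< (c + d) j<e

  prefix₁-two : map inTwoCycles (block false (d + e₁) c) ≡ segment 0 k₁ 0 c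
  prefix₁-two = trans (map-pendantPairs inTwoCycles _ (range (d + e₁) c))
    (placed 0 k₁ _ (d + e₁) 0 c (λ j j<c → wraps _ j k₁ (prefix-own≡ c d e₁ j) (<-≤-trans j<c (c≤k e₁))))

  tail₁-two : map inTwoCycles (block false d e₁) ≡ segment 0 k₁ (c + d) e₁
  tail₁-two = trans (map-pendantPairs inTwoCycles _ (range d e₁))
    (placed 0 k₁ _ d (c + d) e₁ (λ j j<e₁ → stays _ _ k₁ (tail-own≡ c d j) (tail< e₁ j j<e₁)))

  prefix₂-two : map inTwoCycles (block true (d + e₂) c) ≡ segment 1 k₂ 0 c
  prefix₂-two = trans (map-pendantPairs inTwoCycles _ (range (d + e₂) c))
    (placed 1 k₂ _ (d + e₂) 0 c (λ j j<c → wraps _ j k₂ (prefix-own≡ c d e₂ j) (<-≤-trans j<c (c≤k e₂))))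

  tail₂-two : map inTwoCycles (block true d e₂) ≡ segment 1 k₂ (c + d) e₂
  tail₂-two = trans (map-pendantPairs inTwoCycles _ (range d e₂))
    (placed 1 k₂ _ d (c + d) e₂ (λ j j<e₂ → stays _ _ k₂ (tail-own≡ c d j) (tail< e₂ j j<e₂)))

  prefix₁-long : map inLongCycle (block false (d + e₁) c) ≡ segment 0 L k₁ c
  prefix₁-long = trans (map-pendantPairs inLongCycle _ (range (d + e₁) c))
    (placed 0 L _ (d + e₁) k₁ c (λ j j<c → stays _ _ L (prefix₁-long≡ c d e₁ j) (+-monoʳ-< k₁ (<-≤-trans j<c (c≤k e₂)))))

  tail₁-long : map inLongCycle (block false d e₁) ≡ segment 0 L (c + d) e₁
  tail₁-long = trans (map-pendantPairs inLongCycle _ (range d e₁))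
    (placed 0 L _ d (c + d) e₁ (λ j j<e₁ → stays _ _ L (tail-own≡ c d j) (<-≤-trans (tail< e₁ j j<e₁) (m≤m+n k₁ k₂))))

  prefix₂-long : map inLongCycle (block true (d + e₂) c) ≡ segment 0 L 0 c
  prefix₂-long = trans (map-pendantPairs inLongCycle _ (range (d + e₂) c))
    (placed 0 L _ (d + e₂) 0 c (λ j j<c → wraps _ j L (prefix₂-long≡ c d e₁ e₂ j) (<-≤-trans j<c (≤-trans (c≤k e₁) (m≤m+n k₁ k₂)))))

  tail₂-long : map inLongCycle (block true d e₂) ≡ segment 0 L (k₁ + (c + d)) e₂
  tail₂-long = trans (map-pendantPairs inLongCycle _ (range d e₂))
    (placed 0 L _ d (k₁ + (c + d)) e₂ (λ j j<e₂ → stays _ _ L (tail₂-long≡ c d e₁ j)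
      (subst (_< L) (sym (+-assoc k₁ (c + d) j)) (+-monoʳ-< k₁ (tail< e₂ j j<e₂)))))

  segments₃ : ∀ i k s e → pendantPairs (vtx i k) (range s (c + d + e))
                        ≡ segment i k s c ++ segment i k (s + c) d ++ segment i k (s + (c + d)) e
  segments₃ i k s e = begin
    pendantPairs (vtx i k) (range s (c + d + e))
      ≡⟨ cong (pendantPairs (vtx i k)) (trans (range-++ s (c + d) e) (cong (_++ range (s + (c + d)) e) (range-++ s c d))) ⟩
    pendantPairs (vtx i k) ((range s c ++ range (s + c) d) ++ range (s + (c + d)) e)
      ≡⟨ pendantPairs-++ (vtx i k) (range s c ++ range (s + c) d) _ ⟩
    pendantPairs (vtx i k) (range s c ++ range (s + c) d) ++ segment i k (s + (c + d)) e
      ≡⟨ cong (_++ segment i k (s + (c + d)) e) (pendantPairs-++ (vtx i k) (range s c) (range (s + c) d)) ⟩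
    (segment i k s c ++ segment i k (s + c) d) ++ segment i k (s + (c + d)) e
      ≡⟨ ++-assoc (segment i k s c) _ _ ⟩
    segment i k s c ++ segment i k (s + c) d ++ segment i k (s + (c + d)) e ∎
    where open ≡-Reasoning

  twoCycles-segments : compVertices 0 k₁ ++ compVertices 1 k₂
    ≡ segment 0 k₁ 0 c ++ segment 0 k₁ c d ++ segment 0 k₁ (c + d) e₁ ++ segment 1 k₂ 0 c ++ segment 1 k₂ c d ++ segment 1 k₂ (c + d) e₂
  twoCycles-segments = trans (cong₂ _++_ (trans (compVertices≡ 0 k₁) (segments₃ 0 k₁ 0 e₁))
                                         (trans (compVertices≡ 1 k₂) (segments₃ 1 k₂ 0 e₂)))
                             (++-assoc₃ (segment 0 k₁ 0 c) (segment 0 k₁ c d) (segment 0 k₁ (c + d) e₁) _)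

  longCycle-segments : compVertices 0 L
    ≡ segment 0 L 0 c ++ segment 0 L c d ++ segment 0 L (c + d) e₁ ++ segment 0 L k₁ c ++ segment 0 L (k₁ + c) d ++ segment 0 L (k₁ + (c + d)) e₂
  longCycle-segments = begin
    compVertices 0 L
      ≡⟨ trans (compVertices≡ 0 L) (cong (pendantPairs (vtx 0 L)) (range-++ 0 k₁ k₂)) ⟩
    pendantPairs (vtx 0 L) (range 0 k₁ ++ range k₁ k₂)
      ≡⟨ pendantPairs-++ (vtx 0 L) (range 0 k₁) (range k₁ k₂) ⟩
    pendantPairs (vtx 0 L) (range 0 k₁) ++ pendantPairs (vtx 0 L) (range k₁ k₂)
      ≡⟨ cong₂ _++_ (segments₃ 0 L 0 e₁) (segments₃ 0 L k₁ e₂) ⟩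
    (segment 0 L 0 c ++ segment 0 L c d ++ segment 0 L (c + d) e₁) ++ segment 0 L k₁ c ++ segment 0 L (k₁ + c) d ++ segment 0 L (k₁ + (c + d)) e₂
      ≡⟨ ++-assoc₃ (segment 0 L 0 c) (segment 0 L c d) (segment 0 L (c + d) e₁) _ ⟩
    segment 0 L 0 c ++ segment 0 L c d ++ segment 0 L (c + d) e₁ ++ segment 0 L k₁ c ++ segment 0 L (k₁ + c) d ++ segment 0 L (k₁ + (c + d)) e₂ ∎
    where open ≡-Reasoning

  private
    select-image : ∀ (f : BlockVertex → Vertex) Bk X m → map f Bk ≡ X → select X m ≡ map f (select Bk m)
    select-image f Bk X m e = trans (cong (λ t → select t m) (sym e)) (select-map f Bk m)

    map-++₄ : ∀ (f : BlockVertex → Vertex) W X Y Z → map f W ++ map f X ++ map f Y ++ map f Z ≡ map f (W ++ X ++ Y ++ Z)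
    map-++₄ f W X Y Z = sym (trans (map-++ f W _) (cong (map f W ++_) (trans (map-++ f X _) (cong (map f X ++_) (map-++ f Y Z)))))

  module _ (p₁ w₁ t₁ p₂ w₂ t₂ : List Bool)
           (|p₁| : length p₁ ≡ c + c) (|w₁| : length w₁ ≡ d + d) (|t₁| : length t₁ ≡ e₁ + e₁)
           (|p₂| : length p₂ ≡ c + c) (|w₂| : length w₂ ≡ d + d)
           (w₁≡0 : All (_≡ false) w₁) (w₂≡0 : All (_≡ false) w₂) where

    zP₁ zT₁ zP₂ zT₂ : List BlockVertex
    zP₁ = select (block false (d + e₁) c) p₁
    zT₁ = select (block false d e₁) t₁
    zP₂ = select (block true (d + e₂) c) p₂
    zT₂ = select (block true d e₂) t₂

    all-inRange : All InRange zP₁ × All InRange zT₁ × All InRange zP₂ × All InRange zT₂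
    all-inRange = All-select _ p₁ (block-inRange false (d + e₁) c (m≤m+n d e₁) (≤-reflexive (prefix-end≡ c d e₁)))
                , All-select _ t₁ (block-inRange false d e₁ ≤-refl (+-monoˡ-≤ e₁ (m≤n+m d c)))
                , All-select _ p₂ (block-inRange true (d + e₂) c (m≤m+n d e₂) (≤-reflexive (prefix-end≡ c d e₂)))
                , All-select _ t₂ (block-inRange true d e₂ ≤-refl (+-monoˡ-≤ e₂ (m≤n+m d c)))

    twoCycles-selection : select (compVertices 0 k₁ ++ compVertices 1 k₂) (p₁ ++ w₁ ++ t₁ ++ p₂ ++ w₂ ++ t₂)
                        ≡ map inTwoCycles (zP₁ ++ zT₁ ++ zP₂ ++ zT₂)
    twoCycles-selection = begin
      select (compVertices 0 k₁ ++ compVertices 1 k₂) (p₁ ++ w₁ ++ t₁ ++ p₂ ++ w₂ ++ t₂)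
        ≡⟨ cong (λ X → select X (p₁ ++ w₁ ++ t₁ ++ p₂ ++ w₂ ++ t₂)) twoCycles-segments ⟩
      select (segment 0 k₁ 0 c ++ segment 0 k₁ c d ++ segment 0 k₁ (c + d) e₁ ++ segment 1 k₂ 0 c ++ segment 1 k₂ c d ++ segment 1 k₂ (c + d) e₂)
             (p₁ ++ w₁ ++ t₁ ++ p₂ ++ w₂ ++ t₂)
        ≡⟨ select-++₆ (segment 0 k₁ 0 c) (segment 0 k₁ c d) (segment 0 k₁ (c + d) e₁)
                      (segment 1 k₂ 0 c) (segment 1 k₂ c d) (segment 1 k₂ (c + d) e₂) p₁ w₁ t₁ p₂ w₂ t₂
             (trans |p₁| (sym (length-segment 0 k₁ 0 c))) (trans |w₁| (sym (length-segment 0 k₁ c d)))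
             (trans |t₁| (sym (length-segment 0 k₁ (c + d) e₁))) (trans |p₂| (sym (length-segment 1 k₂ 0 c)))
             (trans |w₂| (sym (length-segment 1 k₂ c d))) ⟩
      select (segment 0 k₁ 0 c) p₁ ++ select (segment 0 k₁ c d) w₁ ++ select (segment 0 k₁ (c + d) e₁) t₁
        ++ select (segment 1 k₂ 0 c) p₂ ++ select (segment 1 k₂ c d) w₂ ++ select (segment 1 k₂ (c + d) e₂) t₂
        ≡⟨ cong₂ (λ u v → select (segment 0 k₁ 0 c) p₁ ++ u ++ select (segment 0 k₁ (c + d) e₁) t₁
                          ++ select (segment 1 k₂ 0 c) p₂ ++ v ++ select (segment 1 k₂ (c + d) e₂) t₂)
                 (select-false (segment 0 k₁ c d) w₁ w₁≡0) (select-false (segment 1 k₂ c d) w₂ w₂≡0) ⟩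
      select (segment 0 k₁ 0 c) p₁ ++ select (segment 0 k₁ (c + d) e₁) t₁ ++ select (segment 1 k₂ 0 c) p₂ ++ select (segment 1 k₂ (c + d) e₂) t₂
        ≡⟨ cong₂ _++_ (select-image inTwoCycles _ _ p₁ prefix₁-two) (cong₂ _++_ (select-image inTwoCycles _ _ t₁ tail₁-two)
             (cong₂ _++_ (select-image inTwoCycles _ _ p₂ prefix₂-two) (select-image inTwoCycles _ _ t₂ tail₂-two))) ⟩
      map inTwoCycles zP₁ ++ map inTwoCycles zT₁ ++ map inTwoCycles zP₂ ++ map inTwoCycles zT₂
        ≡⟨ map-++₄ inTwoCycles zP₁ zT₁ zP₂ zT₂ ⟩
      map inTwoCycles (zP₁ ++ zT₁ ++ zP₂ ++ zT₂) ∎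
      where open ≡-Reasoning

    longCycle-selection : select (compVertices 0 L) (p₂ ++ w₁ ++ t₁ ++ p₁ ++ w₂ ++ t₂)
                        ≡ map inLongCycle (zP₂ ++ zT₁ ++ zP₁ ++ zT₂)
    longCycle-selection = begin
      select (compVertices 0 L) (p₂ ++ w₁ ++ t₁ ++ p₁ ++ w₂ ++ t₂)
        ≡⟨ cong (λ X → select X (p₂ ++ w₁ ++ t₁ ++ p₁ ++ w₂ ++ t₂)) longCycle-segments ⟩
      select (segment 0 L 0 c ++ segment 0 L c d ++ segment 0 L (c + d) e₁ ++ segment 0 L k₁ c ++ segment 0 L (k₁ + c) d ++ segment 0 L (k₁ + (c + d)) e₂)
             (p₂ ++ w₁ ++ t₁ ++ p₁ ++ w₂ ++ t₂)
        ≡⟨ select-++₆ (segment 0 L 0 c) (segment 0 L c d) (segment 0 L (c + d) e₁)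
                      (segment 0 L k₁ c) (segment 0 L (k₁ + c) d) (segment 0 L (k₁ + (c + d)) e₂) p₂ w₁ t₁ p₁ w₂ t₂
             (trans |p₂| (sym (length-segment 0 L 0 c))) (trans |w₁| (sym (length-segment 0 L c d)))
             (trans |t₁| (sym (length-segment 0 L (c + d) e₁))) (trans |p₁| (sym (length-segment 0 L k₁ c)))
             (trans |w₂| (sym (length-segment 0 L (k₁ + c) d))) ⟩
      select (segment 0 L 0 c) p₂ ++ select (segment 0 L c d) w₁ ++ select (segment 0 L (c + d) e₁) t₁
        ++ select (segment 0 L k₁ c) p₁ ++ select (segment 0 L (k₁ + c) d) w₂ ++ select (segment 0 L (k₁ + (c + d)) e₂) t₂
        ≡⟨ cong₂ (λ u v → select (segment 0 L 0 c) p₂ ++ u ++ select (segment 0 L (c + d) e₁) t₁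
                          ++ select (segment 0 L k₁ c) p₁ ++ v ++ select (segment 0 L (k₁ + (c + d)) e₂) t₂)
                 (select-false (segment 0 L c d) w₁ w₁≡0) (select-false (segment 0 L (k₁ + c) d) w₂ w₂≡0) ⟩
      select (segment 0 L 0 c) p₂ ++ select (segment 0 L (c + d) e₁) t₁ ++ select (segment 0 L k₁ c) p₁ ++ select (segment 0 L (k₁ + (c + d)) e₂) t₂
        ≡⟨ cong₂ _++_ (select-image inLongCycle _ _ p₂ prefix₂-long) (cong₂ _++_ (select-image inLongCycle _ _ t₁ tail₁-long)
             (cong₂ _++_ (select-image inLongCycle _ _ p₁ prefix₁-long) (select-image inLongCycle _ _ t₂ tail₂-long))) ⟩
      map inLongCycle zP₂ ++ map inLongCycle zT₁ ++ map inLongCycle zP₁ ++ map inLongCycle zT₂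
        ≡⟨ map-++₄ inLongCycle zP₂ zT₁ zP₁ zT₂ ⟩
      map inLongCycle (zP₂ ++ zT₁ ++ zP₁ ++ zT₂) ∎
      where open ≡-Reasoning

    -- Hence the exchange at window c transfers independence: both selected sets are images of
    -- the same block vertices, listed in orders that differ by a permutation.
    exchange-indep⇔ : ∀ j →
      Iff (IsIndepOfSize a j (select (compVertices 0 k₁ ++ compVertices 1 k₂) (p₁ ++ w₁ ++ t₁ ++ p₂ ++ w₂ ++ t₂)))
          (IsIndepOfSize a j (select (compVertices 0 L) (p₂ ++ w₁ ++ t₁ ++ p₁ ++ w₂ ++ t₂)))
    exchange-indep⇔ j =
        (λ I → subst (IsIndepOfSize a j) (sym longCycle-selection) (proj₂ (embedded-indep⇔ inLongCycle longCycle-adj⇔ j _ inZ₂)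
                 (BlockIndep-↭ (reverse₃-↭ zP₁ zT₁ zP₂ zT₂)
                   (proj₁ (embedded-indep⇔ inTwoCycles twoCycles-adj⇔ j _ inZ₁) (subst (IsIndepOfSize a j) twoCycles-selection I)))))
      , (λ I → subst (IsIndepOfSize a j) (sym twoCycles-selection) (proj₂ (embedded-indep⇔ inTwoCycles twoCycles-adj⇔ j _ inZ₁)
                 (BlockIndep-↭ (reverse₃-↭ zP₂ zT₁ zP₁ zT₂)
                   (proj₁ (embedded-indep⇔ inLongCycle longCycle-adj⇔ j _ inZ₂) (subst (IsIndepOfSize a j) longCycle-selection I)))))
      where
      inZ₁ : All InRange (zP₁ ++ zT₁ ++ zP₂ ++ zT₂)
      inZ₁ = let (iP₁ , iT₁ , iP₂ , iT₂) = all-inRange in Allₚ.++⁺ iP₁ (Allₚ.++⁺ iT₁ (Allₚ.++⁺ iP₂ iT₂))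
      inZ₂ : All InRange (zP₂ ++ zT₁ ++ zP₁ ++ zT₂)
      inZ₂ = let (iP₁ , iT₁ , iP₂ , iT₂) = all-inRange in Allₚ.++⁺ iP₂ (Allₚ.++⁺ iT₁ (Allₚ.++⁺ iP₁ iT₂))

-- The merging lemma, for differences a_r ≤ d and sets of at most n vertices: with T = n + 1
-- windows the threshold is K = T·d + 1.
module MergingLemma (a : List ℕ) (d : ℕ) (a≤d : All (_≤ d) a) (n : ℕ) where
  open Counting a

  T K : ℕ
  T = suc n
  K = suc (T * d)

  length-compVertices : ∀ i k → length (compVertices i k) ≡ k + k
  length-compVertices i k = trans (cong length (compVertices≡ i k))
    (trans (length-pendantPairs (vtx i k) (range 0 k)) (cong₂ _+_ (length-range 0 k) (length-range 0 k)))

  count-indep≡count-masks : ∀ j V → count-indep [] j V ≡ count (λ m → IsIndepOfSize? a j (select V m)) (masks (length V))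
  count-indep≡count-masks j V = trans (sym (count-sublists≡count-indep j V))
    (trans (cong (count (IsIndepOfSize? a j)) (sublists≡select-masks V)) (count-map (IsIndepOfSize? a j) (select V) (masks (length V))))

  heavy-not-indep : ∀ j → j ≤ n → ∀ V m → length m ≡ length V → T ≤ weight m → ¬ IsIndepOfSize a j (select V m)
  heavy-not-indep j j≤n V m |m| T≤ (|S| , _) = <⇒≱ (s≤s j≤n) (subst (T ≤_) (trans (sym (length-select V m |m|)) |S|) T≤)

  exchange-indep⇔′ : ∀ k₁ k₂ c e₁ e₂ → c + d + e₁ ≡ k₁ → c + d + e₂ ≡ k₂ → 0 < k₁ → 0 < k₂ →
    ∀ (p₁ w₁ t₁ p₂ w₂ t₂ : List Bool) →
    length p₁ ≡ c + c → length w₁ ≡ d + d → length t₁ ≡ e₁ + e₁ → length p₂ ≡ c + c → length w₂ ≡ d + d →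
    All (_≡ false) w₁ → All (_≡ false) w₂ → ∀ j →
    Iff (IsIndepOfSize a j (select (compVertices 0 k₁ ++ compVertices 1 k₂) (p₁ ++ w₁ ++ t₁ ++ p₂ ++ w₂ ++ t₂)))
        (IsIndepOfSize a j (select (compVertices 0 (k₁ + k₂)) (p₂ ++ w₁ ++ t₁ ++ p₁ ++ w₂ ++ t₂)))
  exchange-indep⇔′ .(c + d + e₁) .(c + d + e₂) c e₁ e₂ refl refl 0<k₁ 0<k₂ =
    Decomposition.exchange-indep⇔ a d a≤d c e₁ e₂ {{>-nonZero 0<k₁}} {{>-nonZero 0<k₂}} {{>-nonZero (≤-trans 0<k₁ (m≤m+n _ _))}}

  module _ (k₁ k₂ : ℕ) (K≤k₁ : K ≤ k₁) (K≤k₂ : K ≤ k₂) where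
    open Exchange d (k₁ + k₁)

    V₁ V₂ : List Vertex
    V₁ = compVertices 0 k₁ ++ compVertices 1 k₂
    V₂ = compVertices 0 (k₁ + k₂)

    N : ℕ
    N = (k₁ + k₁) + (k₂ + k₂)

    |V₁| : length V₁ ≡ N
    |V₁| = trans (length-++ (compVertices 0 k₁)) (cong₂ _+_ (length-compVertices 0 k₁) (length-compVertices 1 k₂))

    |V₂| : length V₂ ≡ N
    |V₂| = trans (length-compVertices 0 (k₁ + k₂)) (interchange k₁ k₂)
      where
      interchange : ∀ x y → (x + y) + (x + y) ≡ (x + x) + (y + y)
      interchange = solve-∀

    T-windows : ∀ k → K ≤ k → T * (d + d) ≤ k + k
    T-windows k K≤k = subst (_≤ k + k) (sym (*-distribˡ-+ T d d)) (+-mono-≤ (≤-trans (n≤1+n _) K≤k) (≤-trans (n≤1+n _) K≤k))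

    H₁ : T * (d + d) ≤ k₁ + k₁
    H₁ = T-windows k₁ K≤k₁
    H₂ : T * (d + d) ≤ k₂ + k₂
    H₂ = T-windows k₂ K≤k₂

    mask-indep⇔ : ∀ j → j ≤ n → ∀ m → length m ≡ N →
      Iff (IsIndepOfSize a j (select V₁ m)) (IsIndepOfSize a j (select V₂ (exchange T m)))
    mask-indep⇔ j j≤n m |m| with exchangeView (k₂ + k₂) T H₁ H₂ m |m|
    ... | heavy ex≡m T≤ = ⊥-elim ∘ heavy-not-indep j j≤n V₁ m (trans |m| (sym |V₁|)) T≤
                        , ⊥-elim ∘ heavy-not-indep j j≤n V₂ m (trans |m| (sym |V₂|)) T≤ ∘ subst (λ m′ → IsIndepOfSize a j (select V₂ m′)) ex≡m
    ... | at i i<T ex≡ w₁≡0 w₂≡0 =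
          subst₂ (λ m₁ m₂ → Iff (IsIndepOfSize a j (select V₁ m₁)) (IsIndepOfSize a j (select V₂ m₂)))
                 (sym (mask-pieces c m)) (sym (trans ex≡ (exchanged-pieces c m)))
                 (exchange-indep⇔′ k₁ k₂ c e₁ e₂ k₁≡ k₂≡ (≤-trans (s≤s z≤n) K≤k₁) (≤-trans (s≤s z≤n) K≤k₂)
                    (prefix c x₁) (window c x₁) (tail c x₁) (prefix c x₂) (window c x₂) (tail c x₂)
                    (proj₁ pieces₁) (proj₁ (proj₂ pieces₁)) (proj₂ (proj₂ pieces₁)) (proj₁ pieces₂) (proj₁ (proj₂ pieces₂))
                    w₁≡0 w₂≡0 j)
      where
      c e₁ e₂ : ℕ
      c  = i * d
      e₁ = k₁ ∸ (c + d)
      e₂ = k₂ ∸ (c + d)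
      x₁ x₂ : List Bool
      x₁ = firstHalf m
      x₂ = secondHalf m
      -- The window fits: c + d = (i + 1)·d ≤ T·d < k.
      k≡ : ∀ k → K ≤ k → c + d + (k ∸ (c + d)) ≡ k
      k≡ k K≤k = m+[n∸m]≡n (≤-trans (≤-reflexive (+-comm c d)) (≤-trans (*-monoˡ-≤ d i<T) (≤-trans (n≤1+n _) K≤k)))
      k₁≡ : c + d + e₁ ≡ k₁
      k₁≡ = k≡ k₁ K≤k₁
      k₂≡ : c + d + e₂ ≡ k₂
      k₂≡ = k≡ k₂ K≤k₂
      pieces₁ : (length (prefix c x₁) ≡ c + c) × (length (window c x₁) ≡ d + d) × (length (tail c x₁) ≡ e₁ + e₁)
      pieces₁ = length-pieces c e₁ k₁ k₁≡ x₁ (length-firstHalf (k₂ + k₂) m |m|)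
      pieces₂ : (length (prefix c x₂) ≡ c + c) × (length (window c x₂) ≡ d + d) × (length (tail c x₂) ≡ e₂ + e₂)
      pieces₂ = length-pieces c e₂ k₂ k₂≡ x₂ (length-secondHalf (k₂ + k₂) m |m|)

    merging : ∀ j → j ≤ n → count-indep [] j V₁ ≡ count-indep [] j V₂
    merging j j≤n = begin
      count-indep [] j V₁                 ≡⟨ count-indep≡count-masks j V₁ ⟩
      count P₁? (masks (length V₁))       ≡⟨ cong (count P₁? ∘ masks) |V₁| ⟩
      count P₁? (masks N)                 ≡⟨ count-cong-on P₁? (P₂? ∘ exchange T) (All.map (mask-indep⇔ j j≤n _) (masks-length N)) ⟩
      count (P₂? ∘ exchange T) (masks N)  ≡⟨ sym (count-involution P₂? (exchange T) (masks N) (masks-unique N) involutive closed) ⟩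
      count P₂? (masks N)                 ≡⟨ cong (count P₂? ∘ masks) (sym |V₂|) ⟩
      count P₂? (masks (length V₂))       ≡⟨ sym (count-indep≡count-masks j V₂) ⟩
      count-indep [] j V₂                 ∎
      where
      open ≡-Reasoning
      P₁? : Decidable (λ m → IsIndepOfSize a j (select V₁ m))
      P₁? m = IsIndepOfSize? a j (select V₁ m)
      P₂? : Decidable (λ m → IsIndepOfSize a j (select V₂ m))
      P₂? m = IsIndepOfSize? a j (select V₂ m)
      involutive : ∀ m → m ∈ masks N → exchange T (exchange T m) ≡ m
      involutive m m∈ = exchange-involutive (k₂ + k₂) T H₁ H₂ m (All.lookup (masks-length N) m∈)
      closed : ∀ m → m ∈ masks N → exchange T m ∈ masks N
      closed m m∈ = ∈-masks N (exchange T m) (exchange-length (k₂ + k₂) T H₁ H₂ m (All.lookup (masks-length N) m∈))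

  merging-property : Merging n K
  merging-property = merging

maximum : List ℕ → ℕ
maximum = foldr _⊔_ 0

≤-maximum : ∀ a → All (_≤ maximum a) a
≤-maximum []       = []
≤-maximum (x ∷ xs) = m≤m⊔n x (maximum xs) ∷ All.map (λ le → ≤-trans le (m≤n⊔m x (maximum xs))) (≤-maximum xs)

-- Corollary 3.6: take d = max a; the merging property holds for K = (n+1)·d + 1, so the count
-- of n-element independent sets depends only on Σ k_i once all k_i ≥ K.
corollary3p6 : (a : List ℕ) → All (0 <_) a → Unique a → (n : ℕ) →
    ∃[ K ] ((ks ks′ : List ℕ) → All (K ≤_) ks → All (K ≤_) ks′ →
      sum ks ≡ sum ks′ → indepCount a n ks ≡ indepCount a n ks′)
corollary3p6 a _ _ n = K , Counting.indepCount-depends-on-sum a (s≤s z≤n) merging-property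
  where open MergingLemma a (maximum a) (≤-maximum a) n
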